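{- Let $\alpha,x,y,z\in\mathbb{C}$ and let $\ell,n,r$ be nonnegative integers. (i) If $x+y+z=\alpha$, then $$(-1)^n\sum_{k=0}^{n+r}\binom{n+r}{k}\binom{\ell+k+r}{r}x^{n+r-k}B_{\ell+k}^{(\alpha)}(y)=(-1)^{\ell+r}\sum_{k=0}^{\ell+r}\binom{\ell+r}{k}\binom{n+k+r}{r}x^{\ell+r-k}B_{n+k}^{(\alpha)}(z)$$ and $$\sum_{k=0}^{n+r}\binom{n+r}{k}\binom{\ell+k+r}{r}x^{n+r-k}B_{\ell+k}^{(\alpha)}(y)=\sum_{k=0}^{\ell+r}\binom{\ell+r}{k}\binom{n+k+r}{r}(-x)^{\ell+r-k}B_{n+k}^{(\alpha)}(x+y).$$ (ii) If $x+y+z=s+1$ where $s$ is a nonnegative integer, then $$S_{n,\ell,r}^{(1)}(x,y,z)=(r+1)\sum_{k=1}^{s}\sum_{j=0}^{r+1}\binom{n+r}{j}\binom{\ell+r}{r+1-j}(y-k)^{\ell+j-1}(x+y-k)^{n+r-j}.$$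
   Context: For $\alpha\in\mathbb{C}$, the generalized Bernoulli polynomials $B_n^{(\alpha)}(x)$ are defined by $\sum_{n\ge0}B_n^{(\alpha)}(x)\frac{t^n}{n!}=\left(\frac{t}{e^t-1}\right)^{\alpha}e^{tx}$ (the power being the formal power series with constant term $1$). For nonnegative integers $n,\ell,r$ and complex $x,y,z$, $$S_{n,\ell,r}^{(\alpha)}(x,y,z)=\sum_{k=0}^{n+r}x^{n+r-k}\binom{n+r}{k}\binom{\ell+k+r}{r}B_{\ell+k}^{(\alpha)}(y)+(-1)^{\ell+n+r+1}\sum_{k=0}^{\ell+r}x^{\ell+r-k}\binom{\ell+r}{k}\binom{n+k+r}{r}B_{n+k}^{(\alpha)}(z).$$ Binomial coefficients $\binom{a}{b}$ with $b>a$ are $0$ and terms with a zero binomial coefficient factor are $0$; empty sums are $0$. -}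

module Defs where

open import Level using (_⊔_)
open import Data.Nat as ℕ using (ℕ; zero; suc)
open import Data.Nat.Combinatorics using (_C_)
open import Data.Nat.Base using (_!)
open import Algebra.Bundles using (CommutativeRing)

ringFromℕ : ∀ {c ℓ} (R : CommutativeRing c ℓ) → ℕ → CommutativeRing.Carrier R
ringFromℕ R zero = CommutativeRing.0# R
ringFromℕ R (suc n) = CommutativeRing._+_ R (CommutativeRing.1# R) (ringFromℕ R n)

-- A commutative ring in which every positive integer is invertible (a ℚ-algebra).
-- ℂ is such a ring; the paper's identities are stated for ℂ.
record QAlgebra (c ℓ : Level.Level) : Set (Level.suc (c ⊔ ℓ)) where
  field
    cring : CommutativeRing c ℓ
  open CommutativeRing cring
  field
    inv      : ℕ → Carrier                       -- inv n = 1/(n+1)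
    inv-spec : ∀ n → ringFromℕ cring (suc n) * inv n ≈ 1#

module Bernoulli {c ℓ} (A : QAlgebra c ℓ) where
  open QAlgebra A public using (inv)
  fromℕ : ℕ → _
  fromℕ = ringFromℕ (QAlgebra.cring A)
  open CommutativeRing (QAlgebra.cring A) public

  pow : Carrier → ℕ → Carrier
  pow x zero = 1#
  pow x (suc n) = x * pow x n

  sumTo : ℕ → (ℕ → Carrier) → Carrier
  sumTo zero f = f 0
  sumTo (suc n) f = sumTo n f + f (suc n)

  sum1 : ℕ → (ℕ → Carrier) → Carrier
  sum1 zero f = 0#
  sum1 (suc n) f = sum1 n f + f (suc n)

  binom : ℕ → ℕ → Carrier
  binom n k = fromℕ (n C k)

  invFact : ℕ → Carrier
  invFact zero = 1#
  invFact (suc m) = inv m * invFact m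

  Series : Set c
  Series = ℕ → Carrier

  oneS : Series
  oneS zero = 1#
  oneS (suc _) = 0#

  mulS : Series → Series → Series
  mulS f g n = sumTo n (λ k → f k * g (n ℕ.∸ k))

  powS : Series → ℕ → Series
  powS f zero = oneS
  powS f (suc j) = mulS f (powS f j)

  -- u(t) = (e^t - 1)/t - 1 = Σ_{m≥1} t^m/(m+1)!   (zero constant term)
  u : Series
  u zero = 0#
  u (suc m) = invFact (suc (suc m))

  fallingFact : Carrier → ℕ → Carrier
  fallingFact β zero = 1#
  fallingFact β (suc j) = fallingFact β j * (β - fromℕ j)

  gbinom : Carrier → ℕ → Carrier
  gbinom β j = fallingFact β j * invFact j

  -- coefficient of t^k in (t/(e^t-1))^α = (1 + u(t))^(-α) = Σ_j (-α choose j) u(t)^j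
  -- (the formal power series with constant term 1; u^j has order ≥ j, so j ≤ k suffices)
  tdCoeff : Carrier → ℕ → Carrier
  tdCoeff α k = sumTo k (λ j → gbinom (- α) j * powS u j k)

  -- generalized Bernoulli polynomial B_n^{(α)}(x) = n! [t^n] (t/(e^t-1))^α e^{tx}
  --   = Σ_{k=0}^n (n choose k) (k! [t^k](t/(e^t-1))^α) x^(n-k)
  B : ℕ → Carrier → Carrier → Carrier
  B n α x = sumTo n (λ k → binom n k * (fromℕ (k ℕ.!) * tdCoeff α k) * pow x (n ℕ.∸ k))

  sgn : ℕ → Carrier
  sgn m = pow (- 1#) m

  S : ℕ → ℕ → ℕ → Carrier → Carrier → Carrier → Carrier → Carrier
  S n l r α x y z =
      sumTo (n ℕ.+ r) (λ k → pow x (n ℕ.+ r ℕ.∸ k) * binom (n ℕ.+ r) k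
                              * binom (l ℕ.+ k ℕ.+ r) r * B (l ℕ.+ k) α y)
    + sgn (l ℕ.+ n ℕ.+ r ℕ.+ 1)
      * sumTo (l ℕ.+ r) (λ k → pow x (l ℕ.+ r ℕ.∸ k) * binom (l ℕ.+ r) k
                              * binom (n ℕ.+ k ℕ.+ r) r * B (n ℕ.+ k) α z)

module Submission where

open import Algebra.Bundles using (CommutativeRing; RawRing)
open import Algebra.Solver.Ring.AlmostCommutativeRing
  using (fromCommutativeRing; _-Raw-AlmostCommutative⟶_)
open import Data.Nat as ℕ using (ℕ; zero; suc; _≤_; _<_; z≤n; s≤s; _∸_; _!)
import Data.Nat.Properties as ℕP
open import Data.Nat.Combinatorics
  using (_C_; nCk≡n!/k![n-k]!; k>n⇒nCk≡0; k![n∸k]!∣n!; nCk+nC[k+1]≡[n+1]C[k+1]; nCk≡nC[n∸k])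
open import Data.Nat.DivMod using (m/n*n≡m)
open import Data.Integer as ℤ using (ℤ; +_; -[1+_]; _⊖_; sign; ∣_∣)
import Data.Integer.Properties as ℤP
open import Data.Sign as Sign using (Sign)
open import Data.Maybe using (Maybe; just; nothing)
open import Data.Product using (_×_; _,_; proj₁)
open import Data.Sum using (inj₁; inj₂)
open import Relation.Nullary using (yes; no; ¬_)
import Relation.Binary.PropositionalEquality as P
open import Defs

-- The standard-library ring solver, instantiated with integer coefficients for an
-- arbitrary commutative ring R.  This needs the canonical ring map ℤ → R; solving an
-- equation then reduces to a syntactic check in ℤ[X₁,…,Xₙ].
module IntegerCoefficientSolver {c ℓ} (R : CommutativeRing c ℓ) where
  open CommutativeRing R
  open import Algebra.Properties.Ring ring using (-0#≈0#; -‿distribˡ-*; -‿+-comm; -‿involutive)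
  open import Relation.Binary.Reasoning.Setoid setoid

  ι : ℕ → Carrier
  ι = ringFromℕ R

  ι-+ : ∀ m n → ι (m ℕ.+ n) ≈ ι m + ι n
  ι-+ zero n = sym (+-identityˡ _)
  ι-+ (suc m) n = trans (+-congˡ (ι-+ m n)) (sym (+-assoc _ _ _))

  ι-* : ∀ m n → ι (m ℕ.* n) ≈ ι m * ι n
  ι-* zero n = sym (zeroˡ _)
  ι-* (suc m) n = begin
    ι (n ℕ.+ m ℕ.* n)     ≈⟨ ι-+ n (m ℕ.* n) ⟩
    ι n + ι (m ℕ.* n)     ≈⟨ +-cong (sym (*-identityˡ _)) (ι-* m n) ⟩
    1# * ι n + ι m * ι n  ≈⟨ sym (distribʳ _ _ _) ⟩
    (1# + ι m) * ι n      ∎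

  signᴿ : Sign → Carrier
  signᴿ Sign.+ = 1#
  signᴿ Sign.- = - 1#

  -- The ring map ℤ → R, first in the form convenient for proofs.
  ⟦_⟧ℤ : ℤ → Carrier
  ⟦ + n ⟧ℤ = ι n
  ⟦ -[1+ n ] ⟧ℤ = - ι (suc n)

  ⊖-hom : ∀ m n → ⟦ m ⊖ n ⟧ℤ ≈ ι m + - ι n
  ⊖-hom m zero = P.subst (λ i → ⟦ i ⟧ℤ ≈ ι m + - 0#) (P.sym (ℤP.⊖-≥ {m} {0} z≤n))
                   (sym (trans (+-congˡ -0#≈0#) (+-identityʳ _)))
  ⊖-hom zero (suc n) = sym (+-identityˡ _)
  ⊖-hom (suc m) (suc n) = P.subst (λ i → ⟦ i ⟧ℤ ≈ ι (suc m) + - ι (suc n)) (P.sym (ℤP.[1+m]⊖[1+n]≡m⊖n m n))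
    (begin
      ⟦ m ⊖ n ⟧ℤ                    ≈⟨ ⊖-hom m n ⟩
      ι m + - ι n                   ≈⟨ +-congʳ (sym (+-identityˡ _)) ⟩
      (0# + ι m) + - ι n            ≈⟨ +-congʳ (+-congʳ (sym (-‿inverseʳ 1#))) ⟩
      ((1# + - 1#) + ι m) + - ι n   ≈⟨ +-congʳ (trans (+-congʳ (+-comm _ _)) (+-assoc _ _ _)) ⟩
      (- 1# + (1# + ι m)) + - ι n   ≈⟨ trans (+-congʳ (+-comm _ _)) (+-assoc _ _ _) ⟩
      (1# + ι m) + (- 1# + - ι n)   ≈⟨ +-congˡ (-‿+-comm 1# (ι n)) ⟩
      (1# + ι m) + - (1# + ι n)     ∎)

  sign-abs : ∀ i → ⟦ i ⟧ℤ ≈ signᴿ (sign i) * ι ∣ i ∣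
  sign-abs (+ n) = sym (*-identityˡ _)
  sign-abs -[1+ n ] = trans (-‿cong (sym (*-identityˡ _))) (-‿distribˡ-* 1# _)

  ◃-hom : ∀ s n → ⟦ s ℤ.◃ n ⟧ℤ ≈ signᴿ s * ι n
  ◃-hom s zero = sym (zeroʳ _)
  ◃-hom Sign.+ (suc n) = sym (*-identityˡ _)
  ◃-hom Sign.- (suc n) = trans (-‿cong (sym (*-identityˡ _))) (-‿distribˡ-* 1# _)

  signᴿ-* : ∀ s t → signᴿ (s Sign.* t) ≈ signᴿ s * signᴿ t
  signᴿ-* Sign.+ t = sym (*-identityˡ _)
  signᴿ-* Sign.- Sign.+ = sym (*-identityʳ _)
  signᴿ-* Sign.- Sign.- =
    sym (trans (sym (-‿distribˡ-* 1# (- 1#))) (trans (-‿cong (*-identityˡ _)) (-‿involutive _)))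

  *-interchange : ∀ a b x y → (a * b) * (x * y) ≈ (a * x) * (b * y)
  *-interchange a b x y = begin
    (a * b) * (x * y) ≈⟨ *-assoc _ _ _ ⟩
    a * (b * (x * y)) ≈⟨ *-congˡ (sym (*-assoc _ _ _)) ⟩
    a * ((b * x) * y) ≈⟨ *-congˡ (*-congʳ (*-comm _ _)) ⟩
    a * ((x * b) * y) ≈⟨ *-congˡ (*-assoc _ _ _) ⟩
    a * (x * (b * y)) ≈⟨ sym (*-assoc _ _ _) ⟩
    (a * x) * (b * y) ∎

  *-hom : ∀ i j → ⟦ i ℤ.* j ⟧ℤ ≈ ⟦ i ⟧ℤ * ⟦ j ⟧ℤ
  *-hom i j = begin
    ⟦ (sign i Sign.* sign j) ℤ.◃ (∣ i ∣ ℕ.* ∣ j ∣) ⟧ℤ  ≈⟨ ◃-hom (sign i Sign.* sign j) (∣ i ∣ ℕ.* ∣ j ∣) ⟩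
    signᴿ (sign i Sign.* sign j) * ι (∣ i ∣ ℕ.* ∣ j ∣) ≈⟨ *-cong (signᴿ-* (sign i) (sign j)) (ι-* ∣ i ∣ ∣ j ∣) ⟩
    (signᴿ (sign i) * signᴿ (sign j)) * (ι ∣ i ∣ * ι ∣ j ∣)
      ≈⟨ *-interchange _ _ _ _ ⟩
    (signᴿ (sign i) * ι ∣ i ∣) * (signᴿ (sign j) * ι ∣ j ∣) ≈⟨ sym (*-cong (sign-abs i) (sign-abs j)) ⟩
    ⟦ i ⟧ℤ * ⟦ j ⟧ℤ ∎

  +-hom : ∀ i j → ⟦ i ℤ.+ j ⟧ℤ ≈ ⟦ i ⟧ℤ + ⟦ j ⟧ℤ
  +-hom -[1+ m ] -[1+ n ] = begin
    - ι (suc (suc (m ℕ.+ n)))  ≈⟨ -‿cong (P.subst (λ k → ι (suc k) ≈ ι (suc m) + ι (suc n))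
                                             (ℕP.+-suc m n) (ι-+ (suc m) (suc n))) ⟩
    - (ι (suc m) + ι (suc n))  ≈⟨ sym (-‿+-comm _ _) ⟩
    - ι (suc m) + - ι (suc n)  ∎
  +-hom -[1+ m ] (+ n) = trans (⊖-hom n (suc m)) (+-comm _ _)
  +-hom (+ m) -[1+ n ] = ⊖-hom m (suc n)
  +-hom (+ m) (+ n) = ι-+ m n

  neg-hom : ∀ i → ⟦ ℤ.- i ⟧ℤ ≈ - ⟦ i ⟧ℤ
  neg-hom -[1+ n ] = sym (-‿involutive _)
  neg-hom (+ zero) = sym -0#≈0#
  neg-hom (+ suc n) = refl

  -- The same map, but sending 1 to 1# on the nose, so that literals in solver
  -- equations evaluate to the ring's own constants.
  ι′ : ℕ → Carrier
  ι′ zero = 0#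
  ι′ (suc zero) = 1#
  ι′ (suc (suc n)) = 1# + ι′ (suc n)

  ι′≈ι : ∀ n → ι′ n ≈ ι n
  ι′≈ι zero = refl
  ι′≈ι (suc zero) = sym (+-identityʳ _)
  ι′≈ι (suc (suc n)) = +-congˡ (ι′≈ι (suc n))

  ⟪_⟫ : ℤ → Carrier
  ⟪ + n ⟫ = ι′ n
  ⟪ -[1+ n ] ⟫ = - ι′ (suc n)

  ⟪⟫≈⟦⟧ℤ : ∀ i → ⟪ i ⟫ ≈ ⟦ i ⟧ℤ
  ⟪⟫≈⟦⟧ℤ (+ n) = ι′≈ι n
  ⟪⟫≈⟦⟧ℤ -[1+ n ] = -‿cong (ι′≈ι (suc n))

  ℤ-rawRing : RawRing _ _
  ℤ-rawRing = record { Carrier = ℤ ; _≈_ = P._≡_ ; _+_ = ℤ._+_ ; _*_ = ℤ._*_ ; -_ = ℤ.-_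
                     ; 0# = + 0 ; 1# = + 1 }

  ⟪⟫-morphism : ℤ-rawRing -Raw-AlmostCommutative⟶ fromCommutativeRing R
  ⟪⟫-morphism = record
    { ⟦_⟧ = ⟪_⟫
    ; +-homo = λ i j → transport (i ℤ.+ j) (+-hom i j) (+-cong (⟪⟫≈⟦⟧ℤ i) (⟪⟫≈⟦⟧ℤ j))
    ; *-homo = λ i j → transport (i ℤ.* j) (*-hom i j) (*-cong (⟪⟫≈⟦⟧ℤ i) (⟪⟫≈⟦⟧ℤ j))
    ; -‿homo = λ i → transport (ℤ.- i) (neg-hom i) (-‿cong (⟪⟫≈⟦⟧ℤ i))
    ; 0-homo = refl ; 1-homo = refl }
    where
    transport : ∀ i {a b} → ⟦ i ⟧ℤ ≈ a → b ≈ a → ⟪ i ⟫ ≈ b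
    transport i p q = trans (⟪⟫≈⟦⟧ℤ i) (trans p (sym q))

  coefficient-test : ∀ i j → Maybe (⟪ i ⟫ ≈ ⟪ j ⟫)
  coefficient-test i j with i ℤ.≟ j
  ... | yes P.refl = just refl
  ... | no _ = nothing

  open import Algebra.Solver.Ring ℤ-rawRing (fromCommutativeRing R) ⟪⟫-morphism coefficient-test public

module Theory {c ℓ} (A : QAlgebra c ℓ) where
  open Bernoulli A
  open QAlgebra A using (inv-spec)
  open import Relation.Binary.Reasoning.MultiSetoid
  open import Algebra.Properties.Ring ring using (-‿distribʳ-*; -1*x≈-x; -‿+-comm; -0#≈0#)
  open IntegerCoefficientSolver (QAlgebra.cring A)
    using (ι-+; ι-*; solve; _:=_; _:+_; _:*_; :-_) renaming (con to κ)

  -- Finite sums Σ_{k=0}^{n}.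

  sumTo-cong≤ : ∀ n {f g : ℕ → Carrier} → (∀ k → k ≤ n → f k ≈ g k) → sumTo n f ≈ sumTo n g
  sumTo-cong≤ zero f≈g = f≈g 0 z≤n
  sumTo-cong≤ (suc n) f≈g = +-cong (sumTo-cong≤ n (λ k k≤n → f≈g k (ℕP.m≤n⇒m≤1+n k≤n))) (f≈g (suc n) ℕP.≤-refl)

  sumTo-cong : ∀ n {f g : ℕ → Carrier} → (∀ k → f k ≈ g k) → sumTo n f ≈ sumTo n g
  sumTo-cong n f≈g = sumTo-cong≤ n (λ k _ → f≈g k)

  sumTo-+ : ∀ n (f g : ℕ → Carrier) → sumTo n (λ k → f k + g k) ≈ sumTo n f + sumTo n g
  sumTo-+ zero f g = refl
  sumTo-+ (suc n) f g = trans (+-congʳ (sumTo-+ n f g))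
    (solve 4 (λ a b x y → (a :+ b) :+ (x :+ y) := (a :+ x) :+ (b :+ y)) refl _ _ _ _)

  sumTo-*l : ∀ n a (f : ℕ → Carrier) → a * sumTo n f ≈ sumTo n (λ k → a * f k)
  sumTo-*l zero a f = refl
  sumTo-*l (suc n) a f = trans (distribˡ _ _ _) (+-congʳ (sumTo-*l n a f))

  sumTo-*r : ∀ n a (f : ℕ → Carrier) → sumTo n f * a ≈ sumTo n (λ k → f k * a)
  sumTo-*r n a f = trans (*-comm _ _) (trans (sumTo-*l n a f) (sumTo-cong n (λ k → *-comm _ _)))

  sumTo-neg : ∀ n (f : ℕ → Carrier) → - sumTo n f ≈ sumTo n (λ k → - f k)
  sumTo-neg zero f = refl
  sumTo-neg (suc n) f = trans (sym (-‿+-comm _ _)) (+-congʳ (sumTo-neg n f))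

  sumTo-zero : ∀ n {f : ℕ → Carrier} → (∀ k → k ≤ n → f k ≈ 0#) → sumTo n f ≈ 0#
  sumTo-zero n f≈0 = trans (sumTo-cong≤ n f≈0) (all0 n)
    where
    all0 : ∀ n → sumTo n (λ _ → 0#) ≈ 0#
    all0 zero = refl
    all0 (suc n) = trans (+-identityʳ _) (all0 n)

  sumTo-head : ∀ n (f : ℕ → Carrier) → sumTo (suc n) f ≈ f 0 + sumTo n (λ k → f (suc k))
  sumTo-head zero f = refl
  sumTo-head (suc n) f = trans (+-congʳ (sumTo-head n f)) (+-assoc _ _ _)

  sumTo-last : ∀ n (f : ℕ → Carrier) → (∀ k → k < n → f k ≈ 0#) → sumTo n f ≈ f n
  sumTo-last zero f _ = refl
  sumTo-last (suc n) f f≈0 = trans (+-congʳ (sumTo-zero n (λ k k≤n → f≈0 k (s≤s k≤n)))) (+-identityˡ _)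

  sumTo-extend : ∀ n m (f : ℕ → Carrier) → n ≤ m → (∀ k → n < k → f k ≈ 0#) → sumTo m f ≈ sumTo n f
  sumTo-extend n m f n≤m f≈0 = P.subst (λ k → sumTo k f ≈ sumTo n f) (ℕP.m+[n∸m]≡n n≤m) (go (m ∸ n))
    where
    go : ∀ d → sumTo (n ℕ.+ d) f ≈ sumTo n f
    go zero = reflexive (P.cong (λ k → sumTo k f) (ℕP.+-identityʳ n))
    go (suc d) = P.subst (λ k → sumTo k f ≈ sumTo n f) (P.sym (ℕP.+-suc n d))
      (trans (+-cong (go d) (f≈0 _ (s≤s (ℕP.m≤m+n n d)))) (+-identityʳ _))

  sumTo-dropPrefix : ∀ l N (f : ℕ → Carrier) → (∀ i → i < l → f i ≈ 0#) →
                     sumTo (l ℕ.+ N) f ≈ sumTo N (λ k → f (l ℕ.+ k))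
  sumTo-dropPrefix zero N f _ = refl
  sumTo-dropPrefix (suc l) N f f≈0 = trans (sumTo-head (l ℕ.+ N) f)
    (trans (+-congʳ (f≈0 0 (s≤s z≤n))) (trans (+-identityˡ _)
      (sumTo-dropPrefix l N (λ i → f (suc i)) (λ i i<l → f≈0 (suc i) (s≤s i<l)))))

  sumTo-swap : ∀ n m (g : ℕ → ℕ → Carrier) →
    sumTo n (λ i → sumTo m (λ j → g i j)) ≈ sumTo m (λ j → sumTo n (λ i → g i j))
  sumTo-swap zero m g = refl
  sumTo-swap (suc n) m g = trans (+-congʳ (sumTo-swap n m g)) (sym (sumTo-+ m _ _))

  sumTo-reverse : ∀ n (f : ℕ → Carrier) → sumTo n f ≈ sumTo n (λ k → f (n ∸ k))
  sumTo-reverse zero f = refl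
  sumTo-reverse (suc n) f = begin⟨ setoid ⟩
    sumTo n f + f (suc n)                  ≈⟨ +-congʳ (sumTo-reverse n f) ⟩
    sumTo n (λ k → f (n ∸ k)) + f (suc n)  ≈⟨ +-comm _ _ ⟩
    f (suc n) + sumTo n (λ k → f (n ∸ k))  ≈⟨ sym (sumTo-head n _) ⟩
    sumTo (suc n) (λ k → f (suc n ∸ k))    ∎

  -- Σ_{j ≤ M} Σ_{p ≤ M-j} h j p = Σ_{k ≤ M} Σ_{j ≤ k} h j (k-j): both run over j + p ≤ M.
  sumTo-triangle : ∀ M (h : ℕ → ℕ → Carrier) →
    sumTo M (λ j → sumTo (M ∸ j) (h j)) ≈ sumTo M (λ k → sumTo k (λ j → h j (k ∸ j)))
  sumTo-triangle zero h = refl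
  sumTo-triangle (suc M) h = begin⟨ setoid ⟩
    sumTo M (λ j → sumTo (suc M ∸ j) (h j)) + sumTo (M ∸ M) (h (suc M))
      ≈⟨ +-congˡ (reflexive (P.cong (λ k → sumTo k (h (suc M))) (ℕP.n∸n≡0 M))) ⟩
    sumTo M (λ j → sumTo (suc M ∸ j) (h j)) + h (suc M) 0
      ≈⟨ +-congʳ (sumTo-cong≤ M growRow) ⟩
    sumTo M (λ j → sumTo (M ∸ j) (h j) + h j (suc M ∸ j)) + h (suc M) 0
      ≈⟨ trans (+-congʳ (sumTo-+ M _ _)) (+-assoc _ _ _) ⟩
    sumTo M (λ j → sumTo (M ∸ j) (h j)) + (sumTo M (λ j → h j (suc M ∸ j)) + h (suc M) 0)
      ≈⟨ +-cong (sumTo-triangle M h) (+-congˡ (reflexive (P.cong (h (suc M)) (P.sym (ℕP.n∸n≡0 (suc M)))))) ⟩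
    sumTo M (λ k → sumTo k (λ j → h j (k ∸ j))) + sumTo (suc M) (λ j → h j (suc M ∸ j)) ∎
    where
    growRow : ∀ j → j ≤ M → sumTo (suc M ∸ j) (h j) ≈ sumTo (M ∸ j) (h j) + h j (suc M ∸ j)
    growRow j j≤M rewrite ℕP.+-∸-assoc 1 j≤M = refl

  sum1-cong : ∀ s {f g : ℕ → Carrier} → (∀ i → f i ≈ g i) → sum1 s f ≈ sum1 s g
  sum1-cong zero _ = refl
  sum1-cong (suc s) f≈g = +-cong (sum1-cong s f≈g) (f≈g (suc s))

  sum1-*l : ∀ s a (f : ℕ → Carrier) → a * sum1 s f ≈ sum1 s (λ i → a * f i)
  sum1-*l zero a f = zeroʳ _
  sum1-*l (suc s) a f = trans (distribˡ _ _ _) (+-congʳ (sum1-*l s a f))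

  sum1-sumTo-swap : ∀ N s (f : ℕ → ℕ → Carrier) →
    sumTo N (λ k → sum1 s (f k)) ≈ sum1 s (λ i → sumTo N (λ k → f k i))
  sum1-sumTo-swap N zero f = sumTo-zero N (λ _ _ → refl)
  sum1-sumTo-swap N (suc s) f = trans (sumTo-+ N _ _) (+-congʳ (sum1-sumTo-swap N s f))

  pow-cong : ∀ {x y} n → x ≈ y → pow x n ≈ pow y n
  pow-cong zero _ = refl
  pow-cong (suc n) x≈y = *-cong x≈y (pow-cong n x≈y)

  pow-+ : ∀ x m n → pow x (m ℕ.+ n) ≈ pow x m * pow x n
  pow-+ x zero n = sym (*-identityˡ _)
  pow-+ x (suc m) n = trans (*-congˡ (pow-+ x m n)) (sym (*-assoc _ _ _))

  pow-* : ∀ x y n → pow (x * y) n ≈ pow x n * pow y n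
  pow-* x y zero = sym (*-identityˡ _)
  pow-* x y (suc n) = trans (*-congˡ (pow-* x y n))
    (solve 4 (λ x y a b → (x :* y) :* (a :* b) := (x :* a) :* (y :* b)) refl x y (pow x n) (pow y n))

  pow-1# : ∀ n → pow 1# n ≈ 1#
  pow-1# zero = refl
  pow-1# (suc n) = trans (*-identityˡ _) (pow-1# n)

  sgn-+ : ∀ m n → sgn (m ℕ.+ n) ≈ sgn m * sgn n
  sgn-+ = pow-+ (- 1#)

  sgn-split : ∀ {n k} → k ≤ n → sgn n ≈ sgn k * sgn (n ∸ k)
  sgn-split {n} {k} k≤n = trans (reflexive (P.cong sgn (P.sym (ℕP.m+[n∸m]≡n k≤n)))) (sgn-+ k (n ∸ k))

  sgn-suc : ∀ n → sgn (suc n) ≈ - sgn n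
  sgn-suc n = -1*x≈-x (sgn n)

  sgn-square : ∀ n → sgn n * sgn n ≈ 1#
  sgn-square n = trans (sym (pow-* (- 1#) (- 1#) n)) (trans (pow-cong n minus-one-squared) (pow-1# n))
    where
    minus-one-squared : - 1# * - 1# ≈ 1#
    minus-one-squared = solve 0 (:- κ (+ 1) :* :- κ (+ 1) := κ (+ 1)) refl

  pow-neg : ∀ x n → pow (- x) n ≈ sgn n * pow x n
  pow-neg x n = trans (pow-cong n (sym (-1*x≈-x x))) (pow-* (- 1#) x n)

  fact : ℕ → Carrier
  fact n = fromℕ (n !)

  fact-suc : ∀ n → fact (suc n) ≈ fromℕ (suc n) * fact n
  fact-suc n = ι-* (suc n) (n !)

  fact-inv : ∀ n → fact n * invFact n ≈ 1#
  fact-inv zero = trans (*-identityʳ _) (+-identityʳ _)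
  fact-inv (suc n) = begin⟨ setoid ⟩
    fact (suc n) * (inv n * invFact n)
      ≈⟨ *-congʳ (fact-suc n) ⟩
    (fromℕ (suc n) * fact n) * (inv n * invFact n)
      ≈⟨ solve 4 (λ a b c d → (a :* b) :* (c :* d) := (a :* c) :* (b :* d)) refl _ _ _ _ ⟩
    (fromℕ (suc n) * inv n) * (fact n * invFact n)
      ≈⟨ trans (*-cong (inv-spec n) (fact-inv n)) (*-identityˡ _) ⟩
    1# ∎

  invFact-suc : ∀ n → fromℕ (suc n) * invFact (suc n) ≈ invFact n
  invFact-suc n = trans (sym (*-assoc _ _ _)) (trans (*-congʳ (inv-spec n)) (*-identityˡ _))

  binom-formula : ∀ {n k} → k ≤ n → binom n k ≈ fact n * (invFact k * invFact (n ∸ k))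
  binom-formula {n} {k} k≤n = begin⟨ setoid ⟩
    binom n k
      ≈⟨ sym (*-identityʳ _) ⟩
    binom n k * 1#
      ≈⟨ *-congˡ (sym (trans (*-congʳ (fact-inv k)) (trans (*-identityˡ _) (fact-inv (n ∸ k))))) ⟩
    binom n k * ((fact k * invFact k) * (fact (n ∸ k) * invFact (n ∸ k)))
      ≈⟨ solve 5 (λ b a a' c c' → b :* ((a :* a') :* (c :* c')) := (b :* (a :* c)) :* (a' :* c')) refl _ _ _ _ _ ⟩
    (binom n k * (fact k * fact (n ∸ k))) * (invFact k * invFact (n ∸ k))
      ≈⟨ *-congʳ binom-times-factorials ⟩
    fact n * (invFact k * invFact (n ∸ k)) ∎
    where
    inℕ : (n C k) ℕ.* (k ! ℕ.* (n ∸ k) !) P.≡ n !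
    inℕ = P.trans (P.cong (ℕ._* (k ! ℕ.* (n ∸ k) !)) (nCk≡n!/k![n-k]! k≤n))
                  (m/n*n≡m {{ℕP._!*_!≢0 k (n ∸ k)}} (k![n∸k]!∣n! k≤n))
    binom-times-factorials : binom n k * (fact k * fact (n ∸ k)) ≈ fact n
    binom-times-factorials = trans (*-congˡ (sym (ι-* (k !) ((n ∸ k) !))))
      (trans (sym (ι-* (n C k) _)) (reflexive (P.cong fromℕ inℕ)))

  binom-zero : ∀ {n k} → n < k → binom n k ≈ 0#
  binom-zero n<k = reflexive (P.cong fromℕ (k>n⇒nCk≡0 n<k))

  binom-pascal : ∀ n k → binom (suc n) (suc k) ≈ binom n k + binom n (suc k)
  binom-pascal n k = trans (reflexive (P.cong fromℕ (P.sym (nCk+nC[k+1]≡[n+1]C[k+1] n k)))) (ι-+ (n C k) (n C suc k))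

  binom-sym : ∀ {n k} → k ≤ n → binom n k ≈ binom n (n ∸ k)
  binom-sym k≤n = reflexive (P.cong fromℕ (nCk≡nC[n∸k] k≤n))

  binom-0 : ∀ n → binom n 0 ≈ 1#
  binom-0 n = trans (binom-formula {n} {0} z≤n) (trans (*-congˡ (*-identityˡ _)) (fact-inv n))

  binomPrev : ℕ → ℕ → Carrier
  binomPrev n zero = 0#
  binomPrev n (suc k) = binom n k

  binom-pascal′ : ∀ n k → binom (suc n) k ≈ binomPrev n k + binom n k
  binom-pascal′ n zero = trans (binom-0 (suc n)) (sym (trans (+-identityˡ _) (binom-0 n)))
  binom-pascal′ n (suc k) = binom-pascal n k

  -- The ring of formal power series (coefficientwise equality, Cauchy product).

  infix 4 _≈ₛ_
  infixl 6 _+ₛ_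
  _≈ₛ_ : Series → Series → Set ℓ
  f ≈ₛ g = ∀ n → f n ≈ g n

  _+ₛ_ : Series → Series → Series
  (f +ₛ g) n = f n + g n

  -ₛ_ : Series → Series
  (-ₛ f) n = - f n

  0ₛ : Series
  0ₛ _ = 0#

  mulS-cong : ∀ {f f′ g g′} → f ≈ₛ f′ → g ≈ₛ g′ → mulS f g ≈ₛ mulS f′ g′
  mulS-cong f≈ g≈ n = sumTo-cong n (λ k → *-cong (f≈ k) (g≈ (n ∸ k)))

  mulS-comm : ∀ f g → mulS f g ≈ₛ mulS g f
  mulS-comm f g n = begin⟨ setoid ⟩
    sumTo n (λ k → f k * g (n ∸ k))              ≈⟨ sumTo-reverse n _ ⟩
    sumTo n (λ k → f (n ∸ k) * g (n ∸ (n ∸ k)))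
      ≈⟨ sumTo-cong≤ n (λ k k≤n → trans (*-comm _ _) (*-congʳ (reflexive (P.cong g (ℕP.m∸[m∸n]≡n k≤n))))) ⟩
    sumTo n (λ k → g k * f (n ∸ k))              ∎

  mulS-assoc : ∀ f g h → mulS (mulS f g) h ≈ₛ mulS f (mulS g h)
  mulS-assoc f g h n = begin⟨ setoid ⟩
    sumTo n (λ k → sumTo k (λ i → f i * g (k ∸ i)) * h (n ∸ k))
      ≈⟨ sumTo-cong n (λ k → sumTo-*r k _ _) ⟩
    sumTo n (λ k → sumTo k (λ i → (f i * g (k ∸ i)) * h (n ∸ k)))
      ≈⟨ sumTo-cong n (λ k → sumTo-cong≤ k (λ i i≤k →
           *-congˡ (reflexive (P.cong (λ m → h (n ∸ m)) (P.sym (ℕP.m+[n∸m]≡n i≤k)))))) ⟩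
    sumTo n (λ k → sumTo k (λ i → (f i * g (k ∸ i)) * h (n ∸ (i ℕ.+ (k ∸ i)))))
      ≈⟨ sym (sumTo-triangle n (λ i p → (f i * g p) * h (n ∸ (i ℕ.+ p)))) ⟩
    sumTo n (λ i → sumTo (n ∸ i) (λ p → (f i * g p) * h (n ∸ (i ℕ.+ p))))
      ≈⟨ sumTo-cong≤ n (λ i _ → trans (sumTo-cong (n ∸ i) (λ p → trans (*-assoc _ _ _)
           (*-congˡ (*-congˡ (reflexive (P.cong h (P.sym (ℕP.∸-+-assoc n i p)))))))) (sym (sumTo-*l (n ∸ i) _ _))) ⟩
    sumTo n (λ i → f i * sumTo (n ∸ i) (λ p → g p * h (n ∸ i ∸ p))) ∎

  mulS-identityˡ : ∀ f → mulS oneS f ≈ₛ f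
  mulS-identityˡ f zero = *-identityˡ _
  mulS-identityˡ f (suc n) = begin⟨ setoid ⟩
    sumTo (suc n) (λ k → oneS k * f (suc n ∸ k))            ≈⟨ sumTo-head n _ ⟩
    1# * f (suc n) + sumTo n (λ k → 0# * f (n ∸ k))         ≈⟨ +-cong (*-identityˡ _) (sumTo-zero n (λ k _ → zeroˡ _)) ⟩
    f (suc n) + 0#                                          ≈⟨ +-identityʳ _ ⟩
    f (suc n) ∎

  mulS-distribʳ : ∀ f g h → mulS (g +ₛ h) f ≈ₛ mulS g f +ₛ mulS h f
  mulS-distribʳ f g h n = trans (sumTo-cong n (λ k → distribʳ _ _ _)) (sumTo-+ n _ _)

  seriesRing : CommutativeRing c ℓ
  seriesRing = record
    { Carrier = Series ; _≈_ = _≈ₛ_ ; _+_ = _+ₛ_ ; _*_ = mulS ; -_ = -ₛ_ ; 0# = 0ₛ ; 1# = oneS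
    ; isCommutativeRing = record
      { isRing = record
        { +-isAbelianGroup = record
          { isGroup = record
            { isMonoid = record
              { isSemigroup = record
                { isMagma = record
                  { isEquivalence = record { refl = λ _ → refl ; sym = λ p n → sym (p n)
                                           ; trans = λ p q n → trans (p n) (q n) }
                  ; ∙-cong = λ p q n → +-cong (p n) (q n) }
                ; assoc = λ f g h n → +-assoc (f n) (g n) (h n) }
              ; identity = (λ f n → +-identityˡ (f n)) , (λ f n → +-identityʳ (f n)) }
            ; inverse = (λ f n → -‿inverseˡ (f n)) , (λ f n → -‿inverseʳ (f n))
            ; ⁻¹-cong = λ p n → -‿cong (p n) }
          ; comm = λ f g n → +-comm (f n) (g n) }
        ; *-cong = mulS-cong
        ; *-assoc = mulS-assoc
        ; *-identity = mulS-identityˡ , (λ f n → trans (mulS-comm f oneS n) (mulS-identityˡ f n))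
        ; distrib = (λ f g h n → trans (mulS-comm f (g +ₛ h) n)
                                  (trans (mulS-distribʳ f g h n) (+-cong (mulS-comm g f n) (mulS-comm h f n))))
                  , mulS-distribʳ }
      ; *-comm = mulS-comm } }

  module Sₛ = CommutativeRing seriesRing
  open IntegerCoefficientSolver seriesRing using ()
    renaming (solve to solveₛ; _:=_ to _=ₛ_; _:+_ to _⊕_; _:*_ to _⊗_; :-_ to ⊝_; con to κₛ)

  *ₛ-congˡ : ∀ f {g g′} → g ≈ₛ g′ → mulS f g ≈ₛ mulS f g′
  *ₛ-congˡ f = Sₛ.*-congˡ {f}

  *ₛ-congʳ : ∀ g {f f′} → f ≈ₛ f′ → mulS f g ≈ₛ mulS f′ g
  *ₛ-congʳ g = Sₛ.*-congʳ {g}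

  constS : Carrier → Series
  constS a zero = a
  constS a (suc n) = 0#

  constS-cong : ∀ {a b} → a ≈ b → constS a ≈ₛ constS b
  constS-cong a≈b zero = a≈b
  constS-cong a≈b (suc n) = refl

  constS-mul : ∀ a g → mulS (constS a) g ≈ₛ (λ n → a * g n)
  constS-mul a g zero = refl
  constS-mul a g (suc n) = begin⟨ setoid ⟩
    sumTo (suc n) (λ k → constS a k * g (suc n ∸ k))   ≈⟨ sumTo-head n _ ⟩
    a * g (suc n) + sumTo n (λ k → 0# * g (n ∸ k))     ≈⟨ +-congˡ (sumTo-zero n (λ k _ → zeroˡ _)) ⟩
    a * g (suc n) + 0#                                 ≈⟨ +-identityʳ _ ⟩
    a * g (suc n) ∎

  constS-+ : ∀ a b → constS a +ₛ constS b ≈ₛ constS (a + b)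
  constS-+ a b zero = refl
  constS-+ a b (suc n) = +-identityˡ _

  constS-* : ∀ a b → mulS (constS a) (constS b) ≈ₛ constS (a * b)
  constS-* a b zero = refl
  constS-* a b (suc n) = trans (constS-mul a (constS b) (suc n)) (zeroʳ _)

  constS-1 : constS 1# ≈ₛ oneS
  constS-1 zero = refl
  constS-1 (suc n) = refl

  constS-0 : constS 0# ≈ₛ 0ₛ
  constS-0 zero = refl
  constS-0 (suc n) = refl

  D : Series → Series
  D f n = fromℕ (suc n) * f (suc n)

  negArg : Series → Series
  negArg f n = sgn n * f n

  e : Carrier → Series
  e a n = pow a n * invFact n

  D-cong : ∀ {f g} → f ≈ₛ g → D f ≈ₛ D g
  D-cong f≈g n = *-congˡ (f≈g (suc n))

  D-+ : ∀ f g → D (f +ₛ g) ≈ₛ D f +ₛ D g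
  D-+ f g n = distribˡ _ _ _

  D-neg : ∀ f → D (-ₛ f) ≈ₛ -ₛ D f
  D-neg f n = sym (-‿distribʳ-* _ _)

  -- Leibniz rule (fg)' = f'g + fg'.  On the n-th coefficient both sides equal
  -- Σ_k (k + (n+1-k)) f_k g_{n+1-k}.
  leibniz : ∀ f g → D (mulS f g) ≈ₛ mulS (D f) g +ₛ mulS f (D g)
  leibniz f g n = sym (begin⟨ setoid ⟩
    sumTo n (λ k → (fromℕ (suc k) * f (suc k)) * g (n ∸ k))
      + sumTo n (λ k → f k * (fromℕ (suc (n ∸ k)) * g (suc (n ∸ k))))
      ≈⟨ +-cong weightLeft weightRight ⟩
    sumTo (suc n) (λ k → fromℕ k * term k) + sumTo (suc n) (λ k → fromℕ (suc n ∸ k) * term k)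
      ≈⟨ sym (sumTo-+ (suc n) _ _) ⟩
    sumTo (suc n) (λ k → fromℕ k * term k + fromℕ (suc n ∸ k) * term k)
      ≈⟨ sumTo-cong≤ (suc n) (λ k k≤ → trans (sym (distribʳ _ _ _))
           (*-congʳ (trans (sym (ι-+ k (suc n ∸ k))) (reflexive (P.cong fromℕ (ℕP.m+[n∸m]≡n k≤)))))) ⟩
    sumTo (suc n) (λ k → fromℕ (suc n) * term k)
      ≈⟨ sym (sumTo-*l (suc n) _ _) ⟩
    fromℕ (suc n) * sumTo (suc n) term ∎)
    where
    term : ℕ → Carrier
    term k = f k * g (suc n ∸ k)
    weightLeft : sumTo n (λ k → (fromℕ (suc k) * f (suc k)) * g (n ∸ k)) ≈ sumTo (suc n) (λ k → fromℕ k * term k)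
    weightLeft = sym (begin⟨ setoid ⟩
      sumTo (suc n) (λ k → fromℕ k * term k)              ≈⟨ sumTo-head n _ ⟩
      0# * term 0 + sumTo n (λ k → fromℕ (suc k) * term (suc k))
        ≈⟨ trans (+-congʳ (zeroˡ _)) (+-identityˡ _) ⟩
      sumTo n (λ k → fromℕ (suc k) * term (suc k))        ≈⟨ sumTo-cong n (λ k → sym (*-assoc _ _ _)) ⟩
      sumTo n (λ k → (fromℕ (suc k) * f (suc k)) * g (n ∸ k)) ∎)
    weightRight : sumTo n (λ k → f k * (fromℕ (suc (n ∸ k)) * g (suc (n ∸ k))))
                ≈ sumTo (suc n) (λ k → fromℕ (suc n ∸ k) * term k)
    weightRight = sym (begin⟨ setoid ⟩
      sumTo n (λ k → fromℕ (suc n ∸ k) * term k) + fromℕ (suc n ∸ suc n) * term (suc n)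
        ≈⟨ +-congˡ (trans (*-congʳ (reflexive (P.cong fromℕ (ℕP.n∸n≡0 n)))) (zeroˡ _)) ⟩
      sumTo n (λ k → fromℕ (suc n ∸ k) * term k) + 0#     ≈⟨ +-identityʳ _ ⟩
      sumTo n (λ k → fromℕ (suc n ∸ k) * term k)
        ≈⟨ sumTo-cong≤ n (λ k k≤ → trans (reflexive (P.cong (λ m → fromℕ m * (f k * g m)) (ℕP.+-∸-assoc 1 k≤)))
             (solve 3 (λ a b c → a :* (b :* c) := b :* (a :* c)) refl _ _ _)) ⟩
      sumTo n (λ k → f k * (fromℕ (suc (n ∸ k)) * g (suc (n ∸ k)))) ∎)

  negArg-mul : ∀ f g → negArg (mulS f g) ≈ₛ mulS (negArg f) (negArg g)
  negArg-mul f g n = trans (sumTo-*l n _ _) (sumTo-cong≤ n (λ k k≤ → trans (*-congʳ (sgn-split k≤))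
     (solve 4 (λ a b x y → (a :* b) :* (x :* y) := (a :* x) :* (b :* y)) refl _ _ _ _)))

  negArg-+ : ∀ f g → negArg (f +ₛ g) ≈ₛ negArg f +ₛ negArg g
  negArg-+ f g n = distribˡ _ _ _

  negArg-neg : ∀ f → negArg (-ₛ f) ≈ₛ -ₛ negArg f
  negArg-neg f n = sym (-‿distribʳ-* _ _)

  negArg-cong : ∀ {f g} → f ≈ₛ g → negArg f ≈ₛ negArg g
  negArg-cong f≈g n = *-congˡ (f≈g n)

  negArg-const : ∀ a → negArg (constS a) ≈ₛ constS a
  negArg-const a zero = *-identityˡ _
  negArg-const a (suc n) = zeroʳ _

  D-negArg : ∀ f → D (negArg f) ≈ₛ -ₛ negArg (D f)
  D-negArg f n = solve 3 (λ a s b → a :* ((:- κ (+ 1) :* s) :* b) := :- (s :* (a :* b))) refl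
                         (fromℕ (suc n)) (sgn n) (f (suc n))

  -- Uniqueness for the linear ODE v·d' = w·d with v(0) = 1 (this is where the
  -- invertibility of the positive integers is used): d(0) = 0 forces d = 0, since the
  -- (n+1)-st coefficient of d is determined by the coefficients up to n.
  ode-zero : ∀ v w d → v 0 ≈ 1# → mulS v (D d) ≈ₛ mulS w d → d 0 ≈ 0# → d ≈ₛ 0ₛ
  ode-zero v w d v0≈1 ode d0≈0 n = vanishUpTo n n ℕP.≤-refl
    where
    vanishUpTo : ∀ n m → m ≤ n → d m ≈ 0#
    nextVanishes : ∀ n → d (suc n) ≈ 0#
    vanishUpTo zero zero _ = d0≈0
    vanishUpTo (suc n) m m≤ with ℕP.m≤n⇒m<n∨m≡n m≤
    ... | inj₁ (s≤s m≤n) = vanishUpTo n m m≤n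
    ... | inj₂ P.refl = nextVanishes n
    nextVanishes n = begin⟨ setoid ⟩
      d (suc n)                                   ≈⟨ sym (*-identityˡ _) ⟩
      1# * d (suc n)                              ≈⟨ *-congʳ (sym (trans (*-comm _ _) (inv-spec n))) ⟩
      (inv n * fromℕ (suc n)) * d (suc n)         ≈⟨ *-assoc _ _ _ ⟩
      inv n * (fromℕ (suc n) * d (suc n))         ≈⟨ trans (*-congˡ scaledVanishes) (zeroʳ _) ⟩
      0# ∎
      where
      scaledVanishes : fromℕ (suc n) * d (suc n) ≈ 0#
      scaledVanishes = begin⟨ setoid ⟩
        fromℕ (suc n) * d (suc n)                 ≈⟨ sym (*-identityʳ _) ⟩
        (fromℕ (suc n) * d (suc n)) * 1#          ≈⟨ *-congˡ (sym (trans (reflexive (P.cong v (ℕP.n∸n≡0 n))) v0≈1)) ⟩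
        (fromℕ (suc n) * d (suc n)) * v (n ∸ n)
          ≈⟨ sym (sumTo-last n _ (λ k k<n → trans (*-congʳ (trans (*-congˡ (vanishUpTo n (suc k) k<n)) (zeroʳ _)))
                                                  (zeroˡ _))) ⟩
        mulS (D d) v n                            ≈⟨ mulS-comm (D d) v n ⟩
        mulS v (D d) n                            ≈⟨ ode n ⟩
        mulS w d n                                ≈⟨ sumTo-zero n (λ k _ → trans (*-congˡ (vanishUpTo n (n ∸ k) (ℕP.m∸n≤m n k)))
                                                                                 (zeroʳ _)) ⟩
        0# ∎

  ode-unique : ∀ v w g h → v 0 ≈ 1# → mulS v (D g) ≈ₛ mulS w g → mulS v (D h) ≈ₛ mulS w h →
               g 0 ≈ h 0 → g ≈ₛ h
  ode-unique v w g h v0≈1 odeG odeH g0≈h0 n =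
    trans (solve 2 (λ a b → a := (a :+ :- b) :+ b) refl (g n) (h n))
      (trans (+-congʳ (ode-zero v w (g +ₛ (-ₛ h)) v0≈1 odeDiff (trans (+-congʳ g0≈h0) (-‿inverseʳ _)) n))
        (+-identityˡ _))
    where
    odeDiff : mulS v (D (g +ₛ (-ₛ h))) ≈ₛ mulS w (g +ₛ (-ₛ h))
    odeDiff = Sₛ.trans (*ₛ-congˡ v (Sₛ.trans (D-+ g (-ₛ h)) (Sₛ.+-congˡ (D-neg h))))
      (Sₛ.trans (solveₛ 3 (λ v a b → v ⊗ (a ⊕ ⊝ b) =ₛ v ⊗ a ⊕ ⊝ (v ⊗ b)) (λ _ → refl) v (D g) (D h))
      (Sₛ.trans (Sₛ.+-cong odeG (Sₛ.-‿cong odeH))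
      (solveₛ 3 (λ w a b → w ⊗ a ⊕ ⊝ (w ⊗ b) =ₛ w ⊗ (a ⊕ ⊝ b)) (λ _ → refl) w g h)))

  e-0 : ∀ a → e a 0 ≈ 1#
  e-0 a = *-identityˡ _

  e-cong : ∀ {a b} → a ≈ b → e a ≈ₛ e b
  e-cong a≈b n = *-congʳ (pow-cong n a≈b)

  D-e : ∀ a → D (e a) ≈ₛ mulS (constS a) (e a)
  D-e a n = begin⟨ setoid ⟩
    fromℕ (suc n) * ((a * pow a n) * (inv n * invFact n))
      ≈⟨ solve 5 (λ k a p i f → k :* ((a :* p) :* (i :* f)) := (k :* i) :* (a :* (p :* f))) refl _ _ _ _ _ ⟩
    (fromℕ (suc n) * inv n) * (a * (pow a n * invFact n))
      ≈⟨ trans (*-congʳ (inv-spec n)) (*-identityˡ _) ⟩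
    a * (pow a n * invFact n)
      ≈⟨ sym (constS-mul a (e a) n) ⟩
    mulS (constS a) (e a) n ∎

  -- e(a)·e(b) = e(a+b): both sides solve f' = (a+b) f with f(0) = 1.
  e-mul : ∀ a b → mulS (e a) (e b) ≈ₛ e (a + b)
  e-mul a b = ode-unique oneS (constS (a + b)) (mulS (e a) (e b)) (e (a + b)) refl odeProduct odeSum
      (trans (*-cong (e-0 a) (e-0 b)) (trans (*-identityˡ _) (sym (e-0 (a + b)))))
    where
    odeProduct : mulS oneS (D (mulS (e a) (e b))) ≈ₛ mulS (constS (a + b)) (mulS (e a) (e b))
    odeProduct = Sₛ.trans (Sₛ.*-identityˡ _) (Sₛ.trans (leibniz (e a) (e b))
      (Sₛ.trans (Sₛ.+-cong (*ₛ-congʳ (e b) (D-e a)) (*ₛ-congˡ (e a) (D-e b)))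
      (Sₛ.trans (solveₛ 4 (λ p q x y → (p ⊗ x) ⊗ y ⊕ x ⊗ (q ⊗ y) =ₛ (p ⊕ q) ⊗ (x ⊗ y))
                          (λ _ → refl) (constS a) (constS b) (e a) (e b))
      (*ₛ-congʳ (mulS (e a) (e b)) (constS-+ a b)))))
    odeSum : mulS oneS (D (e (a + b))) ≈ₛ mulS (constS (a + b)) (e (a + b))
    odeSum = Sₛ.trans (Sₛ.*-identityˡ _) (D-e (a + b))

  negArg-e : ∀ a → negArg (e a) ≈ₛ e (- a)
  negArg-e a n = trans (sym (*-assoc _ _ _)) (*-congʳ (sym (pow-neg a n)))

  -- Linear combinations Σ_j a_j P_j of a family of series in which P_j has order ≥ j
  -- (so the sum is finite in each coefficient).  Such combinations are where the
  -- binomial series Σ_j (β choose j) u^j lives.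

  Triangular : (ℕ → Series) → Set _
  Triangular P = ∀ j n → n < j → P j n ≈ 0#

  combine : (ℕ → Carrier) → (ℕ → Series) → Series
  combine a P n = sumTo n (λ j → a j * P j n)

  combine-extend : ∀ a P → Triangular P → ∀ n M → n ≤ M → sumTo M (λ j → a j * P j n) ≈ combine a P n
  combine-extend a P tri n M n≤M = sumTo-extend n M _ n≤M (λ k n<k → trans (*-congˡ (tri k n n<k)) (zeroʳ _))

  mul-triangular : ∀ g P → Triangular P → Triangular (λ j → mulS g (P j))
  mul-triangular g P tri j n n<j =
    sumTo-zero n (λ k _ → trans (*-congˡ (tri j (n ∸ k) (ℕP.≤-<-trans (ℕP.m∸n≤m n k) n<j))) (zeroʳ _))

  combine-mul : ∀ g a P → Triangular P → mulS g (combine a P) ≈ₛ combine a (λ j → mulS g (P j))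
  combine-mul g a P tri n = begin⟨ setoid ⟩
    sumTo n (λ k → g k * sumTo (n ∸ k) (λ j → a j * P j (n ∸ k)))
      ≈⟨ sumTo-cong n (λ k → *-congˡ (sym (combine-extend a P tri (n ∸ k) n (ℕP.m∸n≤m n k)))) ⟩
    sumTo n (λ k → g k * sumTo n (λ j → a j * P j (n ∸ k)))
      ≈⟨ sumTo-cong n (λ k → sumTo-*l n _ _) ⟩
    sumTo n (λ k → sumTo n (λ j → g k * (a j * P j (n ∸ k))))
      ≈⟨ sumTo-swap n n _ ⟩
    sumTo n (λ j → sumTo n (λ k → g k * (a j * P j (n ∸ k))))
      ≈⟨ sumTo-cong n (λ j → trans (sumTo-cong n (λ k → solve 3 (λ x y z → x :* (y :* z) := y :* (x :* z)) refl _ _ _))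
                                   (sym (sumTo-*l n _ _))) ⟩
    sumTo n (λ j → a j * mulS g (P j) n) ∎

  combine-congP : ∀ a {P P′} → (∀ j → P j ≈ₛ P′ j) → combine a P ≈ₛ combine a P′
  combine-congP a P≈ n = sumTo-cong n (λ j → *-congˡ (P≈ j n))

  combine-congₐ : ∀ {a a′} P → (∀ j → a j ≈ a′ j) → combine a P ≈ₛ combine a′ P
  combine-congₐ P a≈ n = sumTo-cong n (λ j → *-congʳ (a≈ j))

  combine-+ : ∀ a a′ P → combine a P +ₛ combine a′ P ≈ₛ combine (λ j → a j + a′ j) P
  combine-+ a a′ P n = trans (sym (sumTo-+ n _ _)) (sumTo-cong n (λ j → sym (distribʳ _ _ _)))

  combine-scale : ∀ b a P → mulS (constS b) (combine a P) ≈ₛ combine (λ j → b * a j) P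
  combine-scale b a P n = trans (constS-mul b (combine a P) n)
    (trans (sumTo-*l n _ _) (sumTo-cong n (λ j → sym (*-assoc _ _ _))))

  combine-shift : ∀ a a′ P → Triangular P → a′ 0 ≈ 0# → (∀ j → a′ (suc j) ≈ a j) →
                  combine a (λ j → P (suc j)) ≈ₛ combine a′ P
  combine-shift a a′ P tri a′0 a′suc zero =
    trans (trans (*-congˡ (tri 1 0 (s≤s z≤n))) (zeroʳ _)) (sym (trans (*-congʳ a′0) (zeroˡ _)))
  combine-shift a a′ P tri a′0 a′suc (suc m) = begin⟨ setoid ⟩
    sumTo m (λ j → a j * P (suc j) (suc m)) + a (suc m) * P (suc (suc m)) (suc m)
      ≈⟨ trans (+-congˡ (trans (*-congˡ (tri (suc (suc m)) (suc m) ℕP.≤-refl)) (zeroʳ _))) (+-identityʳ _) ⟩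
    sumTo m (λ j → a j * P (suc j) (suc m))
      ≈⟨ sym (trans (+-congʳ (trans (*-congʳ a′0) (zeroˡ _))) (+-identityˡ _)) ⟩
    a′ 0 * P 0 (suc m) + sumTo m (λ j → a j * P (suc j) (suc m))
      ≈⟨ +-congˡ (sumTo-cong m (λ j → *-congʳ (sym (a′suc j)))) ⟩
    a′ 0 * P 0 (suc m) + sumTo m (λ j → a′ (suc j) * P (suc j) (suc m))
      ≈⟨ sym (sumTo-head m _) ⟩
    combine a′ P (suc m) ∎

  -- Powers of u = (eᵗ-1)/t - 1, which has order ≥ 1.
  uPow : ℕ → Series
  uPow j = powS u j

  uPow-triangular : Triangular uPow
  uPow-triangular zero n ()
  uPow-triangular (suc j) n n<sj = sumTo-zero n vanish
    where
    vanish : ∀ k → k ≤ n → u k * uPow j (n ∸ k) ≈ 0#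
    vanish zero _ = zeroˡ _
    vanish (suc k) k≤n = trans (*-congˡ (uPow-triangular j (n ∸ suc k)
      (ℕP.<-≤-trans (ℕP.∸-monoʳ-< {n} {suc k} {0} (s≤s z≤n) k≤n) (ℕP.≤-pred n<sj)))) (zeroʳ _)

  uPowD : ℕ → Series
  uPowD j = mulS (uPow j) (D u)

  uPowD-triangular : Triangular uPowD
  uPowD-triangular j n n<j = trans (mulS-comm (uPow j) (D u) n) (mul-triangular (D u) uPow uPow-triangular j n n<j)

  D-oneS : D oneS ≈ₛ 0ₛ
  D-oneS n = zeroʳ _

  D-uPow : ∀ j → D (uPow (suc j)) ≈ₛ mulS (constS (fromℕ (suc j))) (uPowD j)
  D-uPow zero = Sₛ.trans (leibniz u oneS)
    (Sₛ.trans (Sₛ.+-cong (Sₛ.*-identityʳ (D u)) (Sₛ.trans (*ₛ-congˡ u D-oneS) (Sₛ.zeroʳ u)))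
    (Sₛ.trans (Sₛ.+-identityʳ (D u))
    (Sₛ.sym (Sₛ.trans (*ₛ-congʳ (uPowD 0) (Sₛ.trans (constS-cong (+-identityʳ 1#)) constS-1))
            (Sₛ.trans (Sₛ.*-identityˡ (uPowD 0)) (Sₛ.*-identityˡ (D u)))))))
  D-uPow (suc j) = Sₛ.trans (leibniz u (uPow (suc j)))
    (Sₛ.trans (Sₛ.+-congˡ (*ₛ-congˡ u (D-uPow j)))
    (Sₛ.trans (solveₛ 4 (λ du w pj k → du ⊗ (w ⊗ pj) ⊕ w ⊗ (k ⊗ (pj ⊗ du)) =ₛ (κₛ (+ 1) ⊕ k) ⊗ ((w ⊗ pj) ⊗ du))
                        (λ _ → refl) (D u) u (uPow j) (constS (fromℕ (suc j))))
    (*ₛ-congʳ (uPowD (suc j)) (Sₛ.trans (Sₛ.+-congʳ (Sₛ.sym constS-1)) (constS-+ 1# (fromℕ (suc j)))))))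

  gbinom-recurrence : ∀ β j → fromℕ (suc j) * gbinom β (suc j) + fromℕ j * gbinom β j ≈ β * gbinom β j
  gbinom-recurrence β j = begin⟨ setoid ⟩
    fromℕ (suc j) * ((fallingFact β j * (β - fromℕ j)) * (inv j * invFact j)) + fromℕ j * (fallingFact β j * invFact j)
      ≈⟨ +-congʳ (solve 5 (λ k ff b i iv → k :* ((ff :* b) :* (i :* iv)) := (k :* i) :* ((ff :* iv) :* b))
                        refl _ _ (β - fromℕ j) _ _) ⟩
    (fromℕ (suc j) * inv j) * ((fallingFact β j * invFact j) * (β - fromℕ j)) + fromℕ j * (fallingFact β j * invFact j)
      ≈⟨ +-congʳ (trans (*-congʳ (inv-spec j)) (*-identityˡ _)) ⟩
    (fallingFact β j * invFact j) * (β - fromℕ j) + fromℕ j * (fallingFact β j * invFact j)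
      ≈⟨ solve 3 (λ g b m → g :* (b :+ :- m) :+ m :* g := b :* g) refl _ _ _ ⟩
    β * gbinom β j ∎

  -- The binomial series (1 + u)^β = Σ_j (β choose j) u^j.
  binomialSeries : Carrier → Series
  binomialSeries β = combine (gbinom β) uPow

  D-binomialSeries : ∀ β → D (binomialSeries β) ≈ₛ combine (λ j → fromℕ (suc j) * gbinom β (suc j)) uPowD
  D-binomialSeries β n = begin⟨ setoid ⟩
    fromℕ (suc n) * sumTo (suc n) (λ j → gbinom β j * uPow j (suc n))
      ≈⟨ trans (sumTo-*l (suc n) _ _) (sumTo-cong (suc n) (λ j → solve 3 (λ a b c → a :* (b :* c) := b :* (a :* c)) refl _ _ _)) ⟩
    sumTo (suc n) (λ j → gbinom β j * D (uPow j) n)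
      ≈⟨ sumTo-head n _ ⟩
    gbinom β 0 * D oneS n + sumTo n (λ j → gbinom β (suc j) * D (uPow (suc j)) n)
      ≈⟨ +-cong (trans (*-congˡ (D-oneS n)) (zeroʳ _))
                (sumTo-cong n (λ j → *-congˡ (trans (D-uPow j n) (constS-mul _ (uPowD j) n)))) ⟩
    0# + sumTo n (λ j → gbinom β (suc j) * (fromℕ (suc j) * uPowD j n))
      ≈⟨ trans (+-identityˡ _) (sumTo-cong n (λ j → solve 3 (λ a b c → a :* (b :* c) := (b :* a) :* c) refl _ _ _)) ⟩
    combine (λ j → fromℕ (suc j) * gbinom β (suc j)) uPowD n ∎

  binomialSeries-ode : ∀ β → mulS (oneS +ₛ u) (D (binomialSeries β)) ≈ₛ mulS (constS β) (mulS (D u) (binomialSeries β))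
  binomialSeries-ode β = begin⟨ Sₛ.setoid ⟩
    mulS (oneS +ₛ u) (D (binomialSeries β))
      ≈⟨ *ₛ-congˡ (oneS +ₛ u) (D-binomialSeries β) ⟩
    mulS (oneS +ₛ u) (combine a uPowD)
      ≈⟨ mulS-distribʳ (combine a uPowD) oneS u ⟩
    mulS oneS (combine a uPowD) +ₛ mulS u (combine a uPowD)
      ≈⟨ Sₛ.+-cong (Sₛ.*-identityˡ (combine a uPowD)) uTimes ⟩
    combine a uPowD +ₛ combine a′ uPowD
      ≈⟨ Sₛ.trans (combine-+ a a′ uPowD) (combine-congₐ uPowD (gbinom-recurrence β)) ⟩
    combine (λ j → β * gbinom β j) uPowD
      ≈⟨ Sₛ.sym (combine-scale β (gbinom β) uPowD) ⟩
    mulS (constS β) (combine (gbinom β) uPowD)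
      ≈⟨ *ₛ-congˡ (constS β) (Sₛ.sym (Sₛ.trans (combine-mul (D u) (gbinom β) uPow uPow-triangular)
                                         (combine-congP (gbinom β) (λ j → mulS-comm (D u) (uPow j))))) ⟩
    mulS (constS β) (mulS (D u) (binomialSeries β)) ∎
    where
    a a′ : ℕ → Carrier
    a j = fromℕ (suc j) * gbinom β (suc j)
    a′ j = fromℕ j * gbinom β j
    uTimes : mulS u (combine a uPowD) ≈ₛ combine a′ uPowD
    uTimes = Sₛ.trans (combine-mul u a uPowD uPowD-triangular)
      (Sₛ.trans (combine-congP a (λ j → Sₛ.sym (Sₛ.*-assoc u (uPow j) (D u))))
                (combine-shift a a′ uPowD uPowD-triangular (zeroˡ _) (λ _ → refl)))

  -- The kernel K(α) = (t/(eᵗ-1))^α and the series φ = (eᵗ-1)/t = 1 + u.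

  kernel : Carrier → Series
  kernel α = binomialSeries (- α)

  φ : Series
  φ = oneS +ₛ u

  kernel-0 : ∀ α → kernel α 0 ≈ 1#
  kernel-0 α = trans (*-identityʳ _) (*-identityˡ _)

  φ-0 : φ 0 ≈ 1#
  φ-0 = +-identityʳ _

  φ-coefficient : ∀ n → φ n ≈ invFact (suc n)
  φ-coefficient zero = trans (+-identityʳ _) (sym (trans (*-identityʳ _) inv0≈1))
    where
    inv0≈1 : inv 0 ≈ 1#
    inv0≈1 = trans (sym (*-identityˡ _)) (trans (*-congʳ (sym (+-identityʳ _))) (inv-spec 0))
  φ-coefficient (suc n) = +-identityˡ _

  D-φ : D φ ≈ₛ D u
  D-φ n = trans (distribˡ _ _ _) (trans (+-congʳ (zeroʳ _)) (+-identityˡ _))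

  kernel-ode : ∀ α → mulS φ (D (kernel α)) ≈ₛ mulS (constS (- α)) (mulS (D φ) (kernel α))
  kernel-ode α = Sₛ.trans (binomialSeries-ode (- α))
    (*ₛ-congˡ (constS (- α)) (*ₛ-congʳ (kernel α) (Sₛ.sym D-φ)))

  tS : Series
  tS zero = 0#
  tS (suc zero) = 1#
  tS (suc (suc n)) = 0#

  shift : Series → Series
  shift f zero = 0#
  shift f (suc n) = f n

  tS-mul : ∀ f → mulS tS f ≈ₛ shift f
  tS-mul f zero = zeroˡ _
  tS-mul f (suc n) = begin⟨ setoid ⟩
    sumTo (suc n) (λ k → tS k * f (suc n ∸ k))
      ≈⟨ sumTo-head n _ ⟩
    0# * f (suc n) + sumTo n (λ k → tS (suc k) * f (n ∸ k))
      ≈⟨ trans (+-congʳ (zeroˡ _)) (+-identityˡ _) ⟩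
    sumTo n (λ k → tS (suc k) * f (n ∸ k))
      ≈⟨ firstTermOnly n ⟩
    f n ∎
    where
    firstTermOnly : ∀ n → sumTo n (λ k → tS (suc k) * f (n ∸ k)) ≈ f n
    firstTermOnly zero = *-identityˡ _
    firstTermOnly (suc m) = trans (sumTo-head m _) (trans (+-cong (*-identityˡ _) (sumTo-zero m (λ k _ → zeroˡ _)))
                                                    (+-identityʳ _))

  tS-cancel : ∀ {f g} → mulS tS f ≈ₛ mulS tS g → f ≈ₛ g
  tS-cancel {f} {g} tf≈tg n = trans (sym (tS-mul f (suc n))) (trans (tf≈tg (suc n)) (tS-mul g (suc n)))

  tS-φ : mulS tS φ ≈ₛ e 1# +ₛ (-ₛ oneS)
  tS-φ zero = trans (tS-mul φ 0) (sym (trans (+-congʳ (e-0 1#)) (-‿inverseʳ _)))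
  tS-φ (suc n) = trans (tS-mul φ (suc n)) (trans (φ-coefficient n)
    (sym (trans (+-congˡ -0#≈0#) (trans (+-identityʳ _) (trans (*-congʳ (pow-1# (suc n))) (*-identityˡ _))))))

  negArg-tS : negArg tS ≈ₛ -ₛ tS
  negArg-tS zero = trans (zeroʳ _) (sym -0#≈0#)
  negArg-tS (suc zero) = trans (*-identityʳ _) (*-identityʳ _)
  negArg-tS (suc (suc n)) = trans (zeroʳ _) (sym -0#≈0#)

  negArg-oneS : negArg oneS ≈ₛ oneS
  negArg-oneS zero = *-identityˡ _
  negArg-oneS (suc n) = zeroʳ _

  e-0# : e 0# ≈ₛ oneS
  e-0# zero = *-identityˡ _
  e-0# (suc n) = trans (*-congʳ (zeroˡ _)) (zeroˡ _)

  -- φ(-t) = e^{-t}·φ(t); after multiplying by t both sides are 1 - e^{-t}.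
  negArg-φ : negArg φ ≈ₛ mulS (e (- 1#)) φ
  negArg-φ = tS-cancel (Sₛ.trans reflected (Sₛ.sym scaled))
    where
    reflected : mulS tS (negArg φ) ≈ₛ oneS +ₛ (-ₛ e (- 1#))
    reflected = begin⟨ Sₛ.setoid ⟩
      mulS tS (negArg φ)                         ≈⟨ solveₛ 2 (λ x w → x ⊗ w =ₛ ⊝ ((⊝ x) ⊗ w)) (λ _ → refl) tS (negArg φ) ⟩
      -ₛ mulS (-ₛ tS) (negArg φ)                 ≈⟨ Sₛ.-‿cong (*ₛ-congʳ (negArg φ) (Sₛ.sym negArg-tS)) ⟩
      -ₛ mulS (negArg tS) (negArg φ)             ≈⟨ Sₛ.-‿cong (Sₛ.sym (negArg-mul tS φ)) ⟩
      -ₛ negArg (mulS tS φ)                      ≈⟨ Sₛ.-‿cong (negArg-cong tS-φ) ⟩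
      -ₛ negArg (e 1# +ₛ (-ₛ oneS))
        ≈⟨ Sₛ.-‿cong (Sₛ.trans (negArg-+ (e 1#) (-ₛ oneS))
                       (Sₛ.+-cong (negArg-e 1#) (Sₛ.trans (negArg-neg oneS) (Sₛ.-‿cong negArg-oneS)))) ⟩
      -ₛ (e (- 1#) +ₛ (-ₛ oneS))                 ≈⟨ solveₛ 2 (λ a o → ⊝ (a ⊕ ⊝ o) =ₛ o ⊕ ⊝ a) (λ _ → refl) (e (- 1#)) oneS ⟩
      oneS +ₛ (-ₛ e (- 1#)) ∎
    scaled : mulS tS (mulS (e (- 1#)) φ) ≈ₛ oneS +ₛ (-ₛ e (- 1#))
    scaled = begin⟨ Sₛ.setoid ⟩
      mulS tS (mulS (e (- 1#)) φ)                ≈⟨ solveₛ 3 (λ x a w → x ⊗ (a ⊗ w) =ₛ a ⊗ (x ⊗ w)) (λ _ → refl) tS (e (- 1#)) φ ⟩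
      mulS (e (- 1#)) (mulS tS φ)                ≈⟨ *ₛ-congˡ (e (- 1#)) tS-φ ⟩
      mulS (e (- 1#)) (e 1# +ₛ (-ₛ oneS))        ≈⟨ solveₛ 2 (λ a b → a ⊗ (b ⊕ ⊝ κₛ (+ 1)) =ₛ a ⊗ b ⊕ ⊝ a) (λ _ → refl) (e (- 1#)) (e 1#) ⟩
      mulS (e (- 1#)) (e 1#) +ₛ (-ₛ e (- 1#))    ≈⟨ Sₛ.+-congʳ (Sₛ.trans (e-mul (- 1#) 1#) (Sₛ.trans (e-cong (-‿inverseˡ 1#)) e-0#)) ⟩
      oneS +ₛ (-ₛ e (- 1#)) ∎

  negArg-D : ∀ f → negArg (D f) ≈ₛ -ₛ D (negArg f)
  negArg-D f = Sₛ.trans (solveₛ 1 (λ x → x =ₛ ⊝ (⊝ x)) (λ _ → refl) (negArg (D f))) (Sₛ.-‿cong (Sₛ.sym (D-negArg f)))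

  -- The reflection law K(α)(-t) = e^{αt}·K(α)(t): both sides solve the ODE
  -- φ(-t)·F′ = -α·(φ(-t))′·F with F(0) = 1.
  module Reflection (α : Carrier) where
    β : Carrier
    β = - α

    ψ : Series
    ψ = negArg φ

    reflectedKernel-ode : mulS ψ (D (negArg (kernel α))) ≈ₛ mulS (mulS (constS β) (D ψ)) (negArg (kernel α))
    reflectedKernel-ode = begin⟨ Sₛ.setoid ⟩
      mulS ψ (D (negArg K))
        ≈⟨ *ₛ-congˡ ψ (D-negArg K) ⟩
      mulS ψ (-ₛ negArg (D K))
        ≈⟨ Sₛ.trans (solveₛ 2 (λ a b → a ⊗ ⊝ b =ₛ ⊝ (a ⊗ b)) (λ _ → refl) ψ (negArg (D K)))
                    (Sₛ.-‿cong (Sₛ.sym (negArg-mul φ (D K)))) ⟩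
      -ₛ negArg (mulS φ (D K))
        ≈⟨ Sₛ.-‿cong (negArg-cong (kernel-ode α)) ⟩
      -ₛ negArg (mulS (constS β) (mulS (D φ) K))
        ≈⟨ Sₛ.-‿cong (Sₛ.trans (negArg-mul (constS β) (mulS (D φ) K))
                                (Sₛ.*-cong (negArg-const β) (negArg-mul (D φ) K))) ⟩
      -ₛ mulS (constS β) (mulS (negArg (D φ)) (negArg K))
        ≈⟨ Sₛ.-‿cong (*ₛ-congˡ (constS β) (*ₛ-congʳ (negArg K) (negArg-D φ))) ⟩
      -ₛ mulS (constS β) (mulS (-ₛ D ψ) (negArg K))
        ≈⟨ solveₛ 3 (λ b d g → ⊝ (b ⊗ ((⊝ d) ⊗ g)) =ₛ (b ⊗ d) ⊗ g) (λ _ → refl) (constS β) (D ψ) (negArg K) ⟩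
      mulS (mulS (constS β) (D ψ)) (negArg K) ∎
      where
      K : Series
      K = kernel α

    D-ψ : D ψ ≈ₛ mulS (mulS (constS (- 1#)) (e (- 1#))) φ +ₛ mulS (e (- 1#)) (D φ)
    D-ψ = Sₛ.trans (D-cong negArg-φ) (Sₛ.trans (leibniz (e (- 1#)) φ) (Sₛ.+-congʳ (*ₛ-congʳ φ (D-e (- 1#)))))

    α≈-1·β : constS α ≈ₛ mulS (constS (- 1#)) (constS β)
    α≈-1·β = Sₛ.trans (constS-cong (solve 1 (λ a → a := (:- κ (+ 1)) :* (:- a)) refl α)) (Sₛ.sym (constS-* (- 1#) β))

    twistedKernel-ode : mulS ψ (D (mulS (e α) (kernel α))) ≈ₛ mulS (mulS (constS β) (D ψ)) (mulS (e α) (kernel α))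
    twistedKernel-ode = begin⟨ Sₛ.setoid ⟩
      mulS ψ (D (mulS (e α) K))
        ≈⟨ Sₛ.*-cong negArg-φ (Sₛ.trans (leibniz (e α) K) (Sₛ.+-congʳ (*ₛ-congʳ K (D-e α)))) ⟩
      mulS (mulS E φ) (mulS (mulS (constS α) (e α)) K +ₛ mulS (e α) (D K))
        ≈⟨ solveₛ 6 (λ E w a ea t dt → (E ⊗ w) ⊗ ((a ⊗ ea) ⊗ t ⊕ ea ⊗ dt) =ₛ a ⊗ E ⊗ ea ⊗ w ⊗ t ⊕ (E ⊗ ea) ⊗ (w ⊗ dt))
                    (λ _ → refl) E φ (constS α) (e α) K (D K) ⟩
      mulS (mulS (mulS (mulS (constS α) E) (e α)) φ) K +ₛ mulS (mulS E (e α)) (mulS φ (D K))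
        ≈⟨ Sₛ.+-cong (*ₛ-congʳ K (*ₛ-congʳ φ (*ₛ-congʳ (e α) (*ₛ-congʳ E α≈-1·β))))
                     (*ₛ-congˡ (mulS E (e α)) (kernel-ode α)) ⟩
      mulS (mulS (mulS (mulS (mulS (constS (- 1#)) (constS β)) E) (e α)) φ) K
        +ₛ mulS (mulS E (e α)) (mulS (constS β) (mulS (D φ) K))
        ≈⟨ solveₛ 7 (λ M B E ea w t dv → (M ⊗ B) ⊗ E ⊗ ea ⊗ w ⊗ t ⊕ (E ⊗ ea) ⊗ (B ⊗ (dv ⊗ t))
                                         =ₛ (B ⊗ ((M ⊗ E) ⊗ w ⊕ E ⊗ dv)) ⊗ (ea ⊗ t))
                    (λ _ → refl) (constS (- 1#)) (constS β) E (e α) φ K (D φ) ⟩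
      mulS (mulS (constS β) (mulS (mulS (constS (- 1#)) E) φ +ₛ mulS E (D φ))) (mulS (e α) K)
        ≈⟨ *ₛ-congʳ (mulS (e α) K) (*ₛ-congˡ (constS β) (Sₛ.sym D-ψ)) ⟩
      mulS (mulS (constS β) (D ψ)) (mulS (e α) K) ∎
      where
      K E : Series
      K = kernel α
      E = e (- 1#)

    kernel-reflection : negArg (kernel α) ≈ₛ mulS (e α) (kernel α)
    kernel-reflection = ode-unique ψ (mulS (constS β) (D ψ)) (negArg (kernel α)) (mulS (e α) (kernel α))
      (trans (*-identityˡ _) φ-0) reflectedKernel-ode twistedKernel-ode
      (trans (*-identityˡ _) (sym (trans (*-congʳ (e-0 α)) (*-identityˡ _))))

  open Reflection using (kernel-reflection)

  -- φ·K(1) = 1, i.e. K(1) = t/(eᵗ-1): (φK(1))′ = φ′K(1) - φ′K(1) = 0 and (φK(1))(0) = 1.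
  φ-kernel-1 : mulS φ (kernel 1#) ≈ₛ oneS
  φ-kernel-1 = ode-unique oneS 0ₛ (mulS φ K) oneS refl productConstant oneConstant
    (trans (*-congʳ φ-0) (trans (*-identityˡ _) (kernel-0 1#)))
    where
    K : Series
    K = kernel 1#
    productConstant : mulS oneS (D (mulS φ K)) ≈ₛ mulS 0ₛ (mulS φ K)
    productConstant = begin⟨ Sₛ.setoid ⟩
      mulS oneS (D (mulS φ K))                              ≈⟨ Sₛ.trans (Sₛ.*-identityˡ _) (leibniz φ K) ⟩
      mulS (D φ) K +ₛ mulS φ (D K)                          ≈⟨ Sₛ.+-congˡ (kernel-ode 1#) ⟩
      mulS (D φ) K +ₛ mulS (constS (- 1#)) (mulS (D φ) K)
        ≈⟨ solveₛ 2 (λ x c → x ⊕ c ⊗ x =ₛ (κₛ (+ 1) ⊕ c) ⊗ x) (λ _ → refl) (mulS (D φ) K) (constS (- 1#)) ⟩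
      mulS (oneS +ₛ constS (- 1#)) (mulS (D φ) K)
        ≈⟨ *ₛ-congʳ (mulS (D φ) K) (Sₛ.trans (Sₛ.+-congʳ (Sₛ.sym constS-1))
                     (Sₛ.trans (constS-+ 1# (- 1#)) (Sₛ.trans (constS-cong (-‿inverseʳ 1#)) constS-0))) ⟩
      mulS 0ₛ (mulS (D φ) K)                                ≈⟨ Sₛ.trans (Sₛ.zeroˡ (mulS (D φ) K)) (Sₛ.sym (Sₛ.zeroˡ (mulS φ K))) ⟩
      mulS 0ₛ (mulS φ K) ∎
    oneConstant : mulS oneS (D oneS) ≈ₛ mulS 0ₛ oneS
    oneConstant = Sₛ.trans (Sₛ.*-identityˡ (D oneS)) (Sₛ.trans D-oneS (Sₛ.sym (Sₛ.zeroˡ oneS)))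

  -- Bernoulli polynomials as coefficients: B_n^{(α)}(x) = n!·[tⁿ] K(α)·e(x).  (The
  -- coefficient kernel α k is by definition the number tdCoeff α k used to define B.)

  B-cong : ∀ n α {x x′} → x ≈ x′ → B n α x ≈ B n α x′
  B-cong n α x≈x′ = sumTo-cong n (λ k → *-congˡ (pow-cong (n ∸ k) x≈x′))

  B-as-coefficient : ∀ n α x → B n α x ≈ fact n * mulS (kernel α) (e x) n
  B-as-coefficient n α x = begin⟨ setoid ⟩
    sumTo n (λ k → binom n k * (fact k * kernel α k) * pow x (n ∸ k))
      ≈⟨ sumTo-cong≤ n (λ k k≤ → trans (*-congʳ (*-congʳ (binom-formula k≤)))
           (trans (solve 7 (λ fn ik ink fk t p b → (fn :* (ik :* ink)) :* (fk :* t) :* p := (fn :* (t :* (p :* ink))) :* (fk :* ik))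
                           refl _ _ _ _ _ _ (pow x (n ∸ k)))
           (trans (*-congˡ (fact-inv k)) (*-identityʳ _)))) ⟩
    sumTo n (λ k → fact n * (kernel α k * (pow x (n ∸ k) * invFact (n ∸ k))))
      ≈⟨ sym (sumTo-*l n _ _) ⟩
    fact n * mulS (kernel α) (e x) n ∎

  coefficient-as-B : ∀ n α x → mulS (kernel α) (e x) n ≈ invFact n * B n α x
  coefficient-as-B n α x = sym (trans (*-congˡ (B-as-coefficient n α x))
    (trans (sym (*-assoc _ _ _)) (trans (*-congʳ (trans (*-comm _ _) (fact-inv n))) (*-identityˡ _))))

  -- Addition theorem: B_n(x+y) = Σ_i (n choose i) B_i(y) x^{n-i}, from e(x+y) = e(y)e(x).
  B-addition : ∀ n α x y → B n α (x + y) ≈ sumTo n (λ i → binom n i * B i α y * pow x (n ∸ i))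
  B-addition n α x y = begin⟨ setoid ⟩
    B n α (x + y)
      ≈⟨ B-as-coefficient n α (x + y) ⟩
    fact n * mulS (kernel α) (e (x + y)) n
      ≈⟨ *-congˡ (*ₛ-congˡ (kernel α) (Sₛ.trans (e-cong (+-comm x y)) (Sₛ.sym (e-mul y x))) n) ⟩
    fact n * mulS (kernel α) (mulS (e y) (e x)) n
      ≈⟨ *-congˡ (Sₛ.sym (mulS-assoc (kernel α) (e y) (e x)) n) ⟩
    fact n * sumTo n (λ i → mulS (kernel α) (e y) i * e x (n ∸ i))
      ≈⟨ sumTo-*l n _ _ ⟩
    sumTo n (λ i → fact n * (mulS (kernel α) (e y) i * e x (n ∸ i)))
      ≈⟨ sumTo-cong≤ n (λ i i≤ → trans (*-congˡ (*-congʳ (coefficient-as-B i α y)))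
          (trans (solve 5 (λ fn ii b p ini → fn :* ((ii :* b) :* (p :* ini)) := (fn :* (ii :* ini)) :* b :* p) refl _ _ _ _ _)
          (*-congʳ (*-congʳ (sym (binom-formula i≤)))))) ⟩
    sumTo n (λ i → binom n i * B i α y * pow x (n ∸ i)) ∎

  -- Reflection: B_n^{(α)}(α - w) = (-1)ⁿ B_n^{(α)}(w), from K(α)(-t) = e^{αt}K(α)(t).
  B-reflection : ∀ n α w → B n α (α + - w) ≈ sgn n * B n α w
  B-reflection n α w = begin⟨ setoid ⟩
    B n α (α + - w)
      ≈⟨ B-as-coefficient n α (α + - w) ⟩
    fact n * mulS (kernel α) (e (α + - w)) n
      ≈⟨ *-congˡ (*ₛ-congˡ (kernel α) (Sₛ.sym (e-mul α (- w))) n) ⟩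
    fact n * mulS (kernel α) (mulS (e α) (e (- w))) n
      ≈⟨ *-congˡ (Sₛ.sym (mulS-assoc (kernel α) (e α) (e (- w))) n) ⟩
    fact n * mulS (mulS (kernel α) (e α)) (e (- w)) n
      ≈⟨ *-congˡ (mulS-cong (Sₛ.trans (mulS-comm (kernel α) (e α)) (Sₛ.sym (kernel-reflection α)))
                            (Sₛ.sym (negArg-e w)) n) ⟩
    fact n * mulS (negArg (kernel α)) (negArg (e w)) n
      ≈⟨ *-congˡ (Sₛ.sym (negArg-mul (kernel α) (e w)) n) ⟩
    fact n * (sgn n * mulS (kernel α) (e w) n)
      ≈⟨ solve 3 (λ a b c → a :* (b :* c) := b :* (a :* c)) refl _ _ _ ⟩
    sgn n * (fact n * mulS (kernel α) (e w) n)
      ≈⟨ *-congˡ (sym (B-as-coefficient n α w)) ⟩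
    sgn n * B n α w ∎

  -- K(1)·e(w+1) - K(1)·e(w) = K(1)·e(w)·(eᵗ-1) = K(1)·φ·t·e(w) = t·e(w).
  kernel1-difference : ∀ w → mulS (kernel 1#) (e (w + 1#)) +ₛ (-ₛ mulS (kernel 1#) (e w)) ≈ₛ shift (e w)
  kernel1-difference w = begin⟨ Sₛ.setoid ⟩
    mulS K (e (w + 1#)) +ₛ (-ₛ mulS K (e w))
      ≈⟨ Sₛ.+-congʳ (*ₛ-congˡ K (Sₛ.sym (e-mul w 1#))) ⟩
    mulS K (mulS (e w) (e 1#)) +ₛ (-ₛ mulS K (e w))
      ≈⟨ solveₛ 3 (λ t a b → t ⊗ (a ⊗ b) ⊕ ⊝ (t ⊗ a) =ₛ (t ⊗ a) ⊗ (b ⊕ ⊝ κₛ (+ 1))) (λ _ → refl) K (e w) (e 1#) ⟩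
    mulS (mulS K (e w)) (e 1# +ₛ (-ₛ oneS))
      ≈⟨ *ₛ-congˡ (mulS K (e w)) (Sₛ.sym tS-φ) ⟩
    mulS (mulS K (e w)) (mulS tS φ)
      ≈⟨ solveₛ 4 (λ t a x v → (t ⊗ a) ⊗ (x ⊗ v) =ₛ (x ⊗ a) ⊗ (v ⊗ t)) (λ _ → refl) K (e w) tS φ ⟩
    mulS (mulS tS (e w)) (mulS φ K)
      ≈⟨ Sₛ.trans (*ₛ-congˡ (mulS tS (e w)) φ-kernel-1) (Sₛ.*-identityʳ _) ⟩
    mulS tS (e w)
      ≈⟨ tS-mul (e w) ⟩
    shift (e w) ∎
    where
    K : Series
    K = kernel 1#

  B1-difference : ∀ n w → B n 1# (w + 1#) + - B n 1# w ≈ fromℕ n * pow w (n ∸ 1)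
  B1-difference n w = begin⟨ setoid ⟩
    B n 1# (w + 1#) + - B n 1# w
      ≈⟨ +-cong (B-as-coefficient n 1# (w + 1#)) (-‿cong (B-as-coefficient n 1# w)) ⟩
    fact n * mulS (kernel 1#) (e (w + 1#)) n + - (fact n * mulS (kernel 1#) (e w) n)
      ≈⟨ solve 3 (λ f a b → f :* a :+ :- (f :* b) := f :* (a :+ :- b)) refl _ _ _ ⟩
    fact n * (mulS (kernel 1#) (e (w + 1#)) n + - mulS (kernel 1#) (e w) n)
      ≈⟨ *-congˡ (kernel1-difference w n) ⟩
    fact n * shift (e w) n
      ≈⟨ shifted n ⟩
    fromℕ n * pow w (n ∸ 1) ∎
    where
    shifted : ∀ n → fact n * shift (e w) n ≈ fromℕ n * pow w (n ∸ 1)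
    shifted zero = trans (zeroʳ _) (sym (zeroˡ _))
    shifted (suc m) = trans (*-congʳ (fact-suc m))
      (trans (solve 4 (λ k f p i → (k :* f) :* (p :* i) := (k :* p) :* (f :* i)) refl _ _ _ _)
      (trans (*-congˡ (fact-inv m)) (*-identityʳ _)))

  kernel-0# : kernel 0# ≈ₛ oneS
  kernel-0# zero = kernel-0 0#
  kernel-0# (suc m) = trans (sumTo-head m _)
    (trans (+-cong (zeroʳ _) (sumTo-zero m (λ j _ → trans (*-congʳ (trans (*-congʳ (fallingFact-0 j)) (zeroˡ _))) (zeroˡ _))))
           (+-identityˡ _))
    where
    fallingFact-0 : ∀ j → fallingFact (- 0#) (suc j) ≈ 0#
    fallingFact-0 zero = trans (*-identityˡ _) (trans (+-cong -0#≈0# -0#≈0#) (+-identityˡ _))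
    fallingFact-0 (suc j) = trans (*-congʳ (fallingFact-0 j)) (zeroˡ _)

  B-order0 : ∀ n w → B n 0# w ≈ pow w n
  B-order0 n w = trans (B-as-coefficient n 0# w)
    (trans (*-congˡ (trans (*ₛ-congʳ (e w) kernel-0# n) (mulS-identityˡ (e w) n)))
    (trans (solve 3 (λ f p i → f :* (p :* i) := p :* (f :* i)) refl _ _ _) (trans (*-congˡ (fact-inv n)) (*-identityʳ _))))

  -- The binomial theorem, as the addition theorem of order 0.
  binomial-theorem : ∀ m a b → pow (a + b) m ≈ sumTo m (λ i → binom m i * pow b i * pow a (m ∸ i))
  binomial-theorem m a b = trans (sym (B-order0 m (a + b)))
    (trans (B-addition m 0# a b) (sumTo-cong m (λ i → *-congʳ (*-congˡ (B-order0 i b)))))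

  -- Iterated forward differences Δᴸ F(0) = Σ_k (-1)^{L-k} (L choose k) F(k).

  finDiff : ℕ → (ℕ → Carrier) → Carrier
  finDiff L F = sumTo L (λ k → sgn (L ∸ k) * binom L k * F k)

  finDiff-cong : ∀ L {F G} → (∀ k → k ≤ L → F k ≈ G k) → finDiff L F ≈ finDiff L G
  finDiff-cong L F≈G = sumTo-cong≤ L (λ k k≤ → *-congˡ (F≈G k k≤))

  finDiff-scale : ∀ L a F → finDiff L (λ k → a * F k) ≈ a * finDiff L F
  finDiff-scale L a F = trans (sumTo-cong L (λ k → solve 3 (λ s x y → s :* (x :* y) := x :* (s :* y)) refl _ _ _))
                              (sym (sumTo-*l L a _))

  -- Δ^{L+1} F = Δᴸ (F ∘ suc) - Δᴸ F, by Pascal's rule.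
  finDiff-suc : ∀ L F → finDiff (suc L) F ≈ finDiff L (λ k → F (suc k)) + - finDiff L F
  finDiff-suc L F = begin⟨ setoid ⟩
    finDiff (suc L) F
      ≈⟨ sumTo-cong (suc L) (λ j → *-congʳ (trans (*-congˡ (binom-pascal′ L j)) (distribˡ _ _ _))) ⟩
    sumTo (suc L) (λ j → (sgn (suc L ∸ j) * binomPrev L j + sgn (suc L ∸ j) * binom L j) * F j)
      ≈⟨ trans (sumTo-cong (suc L) (λ j → distribʳ _ _ _)) (sumTo-+ (suc L) _ _) ⟩
    sumTo (suc L) (λ j → sgn (suc L ∸ j) * binomPrev L j * F j) + sumTo (suc L) (λ j → sgn (suc L ∸ j) * binom L j * F j)
      ≈⟨ +-cong shiftedPart unshiftedPart ⟩
    finDiff L (λ k → F (suc k)) + - finDiff L F ∎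
    where
    shiftedPart : sumTo (suc L) (λ j → sgn (suc L ∸ j) * binomPrev L j * F j) ≈ finDiff L (λ k → F (suc k))
    shiftedPart = trans (sumTo-head L _) (trans (+-congʳ (trans (*-congʳ (zeroʳ _)) (zeroˡ _))) (+-identityˡ _))
    unshiftedPart : sumTo (suc L) (λ j → sgn (suc L ∸ j) * binom L j * F j) ≈ - finDiff L F
    unshiftedPart = begin⟨ setoid ⟩
      sumTo L (λ j → sgn (suc L ∸ j) * binom L j * F j) + sgn (suc L ∸ suc L) * binom L (suc L) * F (suc L)
        ≈⟨ trans (+-congˡ (trans (*-congʳ (trans (*-congˡ (binom-zero (ℕP.n<1+n L))) (zeroʳ _))) (zeroˡ _)))
                 (+-identityʳ _) ⟩
      sumTo L (λ j → sgn (suc L ∸ j) * binom L j * F j)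
        ≈⟨ sumTo-cong≤ L (λ j j≤ → trans (*-congʳ (*-congʳ (trans (reflexive (P.cong sgn (ℕP.+-∸-assoc 1 j≤))) (sgn-suc (L ∸ j)))))
             (solve 3 (λ s b f → (:- s) :* b :* f := :- (s :* b :* f)) refl _ _ _)) ⟩
      sumTo L (λ j → - (sgn (L ∸ j) * binom L j * F j))
        ≈⟨ sym (sumTo-neg L _) ⟩
      - finDiff L F ∎

  finDiff-binom : ∀ L N d → finDiff L (λ k → binom (N ℕ.+ k) (L ℕ.+ d)) ≈ binom N d
  finDiff-binom zero N d = trans (*-congʳ (trans (*-identityˡ _) (binom-0 0)))
    (trans (*-identityˡ _) (reflexive (P.cong (λ m → binom m d) (ℕP.+-identityʳ N))))
  finDiff-binom (suc L) N d = begin⟨ setoid ⟩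
    finDiff (suc L) (λ k → binom (N ℕ.+ k) (suc L ℕ.+ d))
      ≈⟨ finDiff-suc L _ ⟩
    finDiff L (λ k → binom (N ℕ.+ suc k) (suc (L ℕ.+ d))) + - finDiff L (λ k → binom (N ℕ.+ k) (suc (L ℕ.+ d)))
      ≈⟨ +-cong (finDiff-cong L (λ k _ → reflexive (P.cong₂ binom (ℕP.+-suc N k) (P.sym (ℕP.+-suc L d)))))
                (-‿cong (finDiff-cong L (λ k _ → reflexive (P.cong (binom (N ℕ.+ k)) (P.sym (ℕP.+-suc L d)))))) ⟩
    finDiff L (λ k → binom (suc N ℕ.+ k) (L ℕ.+ suc d)) + - finDiff L (λ k → binom (N ℕ.+ k) (L ℕ.+ suc d))
      ≈⟨ +-cong (finDiff-binom L (suc N) (suc d)) (-‿cong (finDiff-binom L N (suc d))) ⟩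
    binom (suc N) (suc d) + - binom N (suc d)
      ≈⟨ +-congʳ (binom-pascal N d) ⟩
    (binom N d + binom N (suc d)) + - binom N (suc d)
      ≈⟨ solve 2 (λ a b → (a :+ b) :+ :- b := a) refl _ _ ⟩
    binom N d ∎

  finDiff-binom-low : ∀ L N M → M < L → finDiff L (λ k → binom (N ℕ.+ k) M) ≈ 0#
  finDiff-binom-low (suc L) N M M<L = trans (finDiff-suc L _)
    (trans (+-congʳ (finDiff-cong L (λ k _ → reflexive (P.cong (λ m → binom m M) (ℕP.+-suc N k)))))
           (byCases (ℕP.m≤n⇒m<n∨m≡n (ℕP.≤-pred M<L))))
    where
    atTop : ∀ N → finDiff M (λ k → binom (N ℕ.+ k) M) ≈ 1#
    atTop N = trans (finDiff-cong M (λ k _ → reflexive (P.cong (binom (N ℕ.+ k)) (P.sym (ℕP.+-identityʳ M)))))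
                    (trans (finDiff-binom M N 0) (binom-0 N))
    byCases : _ → finDiff L (λ k → binom (suc N ℕ.+ k) M) + - finDiff L (λ k → binom (N ℕ.+ k) M) ≈ 0#
    byCases (inj₁ M<L′) = trans (+-cong (finDiff-binom-low L (suc N) M M<L′) (-‿cong (finDiff-binom-low L N M M<L′)))
                                (trans (+-congˡ -0#≈0#) (+-identityʳ _))
    byCases (inj₂ P.refl) = trans (+-cong (atTop (suc N)) (-‿cong (atTop N))) (-‿inverseʳ _)

  -- (P+r choose r)(P choose i) = (i+r choose r)(P+r choose i+r): both count the
  -- multinomial (P+r)! / (r! i! (P-i)!).
  binom-trinomial : ∀ P r i → binom (P ℕ.+ r) r * binom P i ≈ binom (i ℕ.+ r) r * binom (P ℕ.+ r) (i ℕ.+ r)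
  binom-trinomial P r i with i ℕ.≤? P
  ... | yes i≤P = begin⟨ setoid ⟩
    binom (P ℕ.+ r) r * binom P i
      ≈⟨ *-cong (trans (binom-formula (ℕP.m≤n+m r P)) (*-congˡ (*-congˡ (reflexive (P.cong invFact (ℕP.m+n∸n≡m P r))))))
                (binom-formula i≤P) ⟩
    fact (P ℕ.+ r) * (invFact r * invFact P) * (fact P * (invFact i * invFact (P ∸ i)))
      ≈⟨ solve 6 (λ a b c d e f → a :* (b :* c) :* (d :* (e :* f)) := (d :* c) :* (a :* b :* e :* f)) refl _ _ _ _ _ _ ⟩
    (fact P * invFact P) * (fact (P ℕ.+ r) * invFact r * invFact i * invFact (P ∸ i))
      ≈⟨ trans (*-congʳ (fact-inv P)) (*-identityˡ _) ⟩
    fact (P ℕ.+ r) * invFact r * invFact i * invFact (P ∸ i)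
      ≈⟨ sym (trans (*-congʳ (fact-inv (i ℕ.+ r))) (*-identityˡ _)) ⟩
    (fact (i ℕ.+ r) * invFact (i ℕ.+ r)) * (fact (P ℕ.+ r) * invFact r * invFact i * invFact (P ∸ i))
      ≈⟨ solve 6 (λ a b c d e f → (a :* b) :* (c :* d :* e :* f) := a :* (d :* e) :* (c :* (b :* f))) refl _ _ _ _ _ _ ⟩
    fact (i ℕ.+ r) * (invFact r * invFact i) * (fact (P ℕ.+ r) * (invFact (i ℕ.+ r) * invFact (P ∸ i)))
      ≈⟨ sym (*-cong (trans (binom-formula (ℕP.m≤n+m r i)) (*-congˡ (*-congˡ (reflexive (P.cong invFact (ℕP.m+n∸n≡m i r))))))
                     (trans (binom-formula (ℕP.+-monoˡ-≤ r i≤P)) (*-congˡ (*-congˡ (reflexive (P.cong invFact difference)))))) ⟩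
    binom (i ℕ.+ r) r * binom (P ℕ.+ r) (i ℕ.+ r) ∎
    where
    difference : (P ℕ.+ r) ∸ (i ℕ.+ r) P.≡ P ∸ i
    difference = P.trans (P.cong₂ _∸_ (ℕP.+-comm P r) (ℕP.+-comm i r)) (ℕP.[m+n]∸[m+o]≡n∸o r P i)
  ... | no i≰P = trans (trans (*-congˡ (binom-zero (ℕP.≰⇒> i≰P))) (zeroʳ _))
                       (sym (trans (*-congˡ (binom-zero (ℕP.+-monoˡ-< r (ℕP.≰⇒> i≰P)))) (zeroʳ _)))

  -- Expanding the right side, the coefficient of c_i x^{M-i}
  -- (M = l+N) is a finite difference Δᴸ which the lemmas above evaluate.
  module Generic (l n r : ℕ) where
    L N M : ℕ
    L = l ℕ.+ r
    N = n ℕ.+ r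
    M = l ℕ.+ N

    weight : ℕ → Carrier
    weight i = finDiff L (λ k → binom (n ℕ.+ k ℕ.+ r) r * binom (n ℕ.+ k) i)

    weight-as-finDiff : ∀ i → weight i ≈ binom (i ℕ.+ r) r * finDiff L (λ k → binom (N ℕ.+ k) (i ℕ.+ r))
    weight-as-finDiff i = trans (finDiff-cong L (λ k _ → trans (binom-trinomial (n ℕ.+ k) r i)
                                 (*-congˡ (reflexive (P.cong (λ m → binom m (i ℕ.+ r)) (regroup k))))))
                                (finDiff-scale L _ _)
      where
      regroup : ∀ k → n ℕ.+ k ℕ.+ r P.≡ N ℕ.+ k
      regroup k = P.trans (ℕP.+-assoc n k r) (P.trans (P.cong (n ℕ.+_) (ℕP.+-comm k r)) (P.sym (ℕP.+-assoc n r k)))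

    weight-low : ∀ i → i < l → weight i ≈ 0#
    weight-low i i<l = trans (weight-as-finDiff i) (trans (*-congˡ (finDiff-binom-low L N (i ℕ.+ r) (ℕP.+-monoˡ-< r i<l))) (zeroʳ _))

    weight-high : ∀ k → weight (l ℕ.+ k) ≈ binom N k * binom (l ℕ.+ k ℕ.+ r) r
    weight-high k = trans (weight-as-finDiff (l ℕ.+ k))
      (trans (*-congˡ (trans (finDiff-cong L (λ j _ → reflexive (P.cong (binom (N ℕ.+ j)) regroup))) (finDiff-binom L N k)))
             (*-comm _ _))
      where
      regroup : l ℕ.+ k ℕ.+ r P.≡ L ℕ.+ k
      regroup = P.trans (ℕP.+-assoc l k r) (P.trans (P.cong (l ℕ.+_) (ℕP.+-comm k r)) (P.sym (ℕP.+-assoc l r k)))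

    exponent-sum : ∀ {k i} → k ≤ L → i ≤ n ℕ.+ k → (L ∸ k) ℕ.+ ((n ℕ.+ k) ∸ i) P.≡ M ∸ i
    exponent-sum {k} {i} k≤L i≤ = P.trans (P.sym (ℕP.+-∸-assoc (L ∸ k) i≤)) (P.cong (_∸ i) total)
      where
      total : (L ∸ k) ℕ.+ (n ℕ.+ k) P.≡ M
      total = P.trans (P.cong ((L ∸ k) ℕ.+_) (ℕP.+-comm n k)) (P.trans (P.sym (ℕP.+-assoc (L ∸ k) k n))
           (P.trans (P.cong (ℕ._+ n) (ℕP.m∸n+n≡m k≤L)) (P.trans (ℕP.+-assoc l r n) (P.cong (l ℕ.+_) (ℕP.+-comm r n)))))

    n+k≤M : ∀ {k} → k ≤ L → n ℕ.+ k ≤ M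
    n+k≤M {k} k≤L = ℕP.≤-trans (ℕP.+-monoʳ-≤ n k≤L) (ℕP.≤-reflexive n+L≡M)
      where
      n+L≡M : n ℕ.+ L P.≡ M
      n+L≡M = P.trans (P.sym (ℕP.+-assoc n l r)) (P.trans (P.cong (ℕ._+ r) (ℕP.+-comm n l)) (ℕP.+-assoc l n r))

    module _ (cseq : ℕ → Carrier) (x : Carrier) where
      genericLeft genericRight expanded : Carrier
      genericLeft = sumTo N (λ k → binom N k * binom (l ℕ.+ k ℕ.+ r) r * pow x (N ∸ k) * cseq (l ℕ.+ k))
      genericRight = sumTo L (λ k → binom L k * binom (n ℕ.+ k ℕ.+ r) r * pow (- x) (L ∸ k)
                                     * sumTo (n ℕ.+ k) (λ i → binom (n ℕ.+ k) i * cseq i * pow x (n ℕ.+ k ∸ i)))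
      expanded = sumTo M (λ i → weight i * (cseq i * pow x (M ∸ i)))

      -- Only the weights with i ≥ l survive, and they are the left-hand coefficients.
      genericLeft≈expanded : genericLeft ≈ expanded
      genericLeft≈expanded = sym (trans (sumTo-dropPrefix l N _ (λ i i<l → trans (*-congʳ (weight-low i i<l)) (zeroˡ _)))
        (sumTo-cong N (λ k → trans (*-congʳ (weight-high k))
          (trans (*-congˡ (*-congˡ (reflexive (P.cong (pow x) (ℕP.[m+n]∸[m+o]≡n∸o l N k)))))
                 (solve 4 (λ a b c p → (a :* b) :* (c :* p) := a :* b :* p :* c) refl _ _ _ _)))))

      term : ℕ → ℕ → Carrier
      term k i = (sgn (L ∸ k) * binom L k * (binom (n ℕ.+ k ℕ.+ r) r * binom (n ℕ.+ k) i)) * (cseq i * pow x (M ∸ i))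

      term≈ : ∀ k i → k ≤ L → i ≤ n ℕ.+ k →
        binom L k * binom (n ℕ.+ k ℕ.+ r) r * pow (- x) (L ∸ k) * (binom (n ℕ.+ k) i * cseq i * pow x (n ℕ.+ k ∸ i))
          ≈ term k i
      term≈ k i k≤L i≤ = begin⟨ setoid ⟩
        binom L k * binom (n ℕ.+ k ℕ.+ r) r * pow (- x) (L ∸ k) * (binom (n ℕ.+ k) i * cseq i * pow x (n ℕ.+ k ∸ i))
          ≈⟨ *-congʳ (*-congˡ (pow-neg x (L ∸ k))) ⟩
        binom L k * binom (n ℕ.+ k ℕ.+ r) r * (sgn (L ∸ k) * pow x (L ∸ k)) * (binom (n ℕ.+ k) i * cseq i * pow x (n ℕ.+ k ∸ i))
          ≈⟨ solve 7 (λ a b s p1 d e p2 → a :* b :* (s :* p1) :* (d :* e :* p2) := (s :* a :* (b :* d)) :* (e :* (p1 :* p2)))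
                     refl _ _ _ _ _ _ _ ⟩
        (sgn (L ∸ k) * binom L k * (binom (n ℕ.+ k ℕ.+ r) r * binom (n ℕ.+ k) i)) * (cseq i * (pow x (L ∸ k) * pow x (n ℕ.+ k ∸ i)))
          ≈⟨ *-congˡ (*-congˡ (trans (sym (pow-+ x (L ∸ k) (n ℕ.+ k ∸ i))) (reflexive (P.cong (pow x) (exponent-sum k≤L i≤))))) ⟩
        term k i ∎

      genericRight≈expanded : genericRight ≈ expanded
      genericRight≈expanded = begin⟨ setoid ⟩
        genericRight
          ≈⟨ sumTo-cong≤ L (λ k k≤L → trans (sumTo-*l (n ℕ.+ k) _ _) (sumTo-cong≤ (n ℕ.+ k) (λ i i≤ → term≈ k i k≤L i≤))) ⟩
        sumTo L (λ k → sumTo (n ℕ.+ k) (term k))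
          ≈⟨ sumTo-cong≤ L (λ k k≤L → sym (sumTo-extend (n ℕ.+ k) M (term k) (n+k≤M k≤L) (λ i i> →
               trans (*-congʳ (trans (*-congˡ (trans (*-congˡ (binom-zero i>)) (zeroʳ _))) (zeroʳ _))) (zeroˡ _)))) ⟩
        sumTo L (λ k → sumTo M (term k))
          ≈⟨ sumTo-swap L M _ ⟩
        sumTo M (λ i → sumTo L (λ k → term k i))
          ≈⟨ sumTo-cong M (λ i → sym (sumTo-*r L _ _)) ⟩
        expanded ∎

      generic-identity : genericLeft ≈ genericRight
      generic-identity = trans genericLeft≈expanded (sym genericRight≈expanded)

  -- Part (i).  The second identity is the generic one for c_i = B_i(y), folded by the
  -- addition theorem; the first follows from it by reflection, as z = α - (x+y).
  part-i : ∀ (α x y z : Carrier) (l n r : ℕ) → x + y + z ≈ α →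
      (sgn n * sumTo (n ℕ.+ r) (λ k → binom (n ℕ.+ r) k * binom (l ℕ.+ k ℕ.+ r) r
                                      * pow x (n ℕ.+ r ℕ.∸ k) * B (l ℕ.+ k) α y)
        ≈ sgn (l ℕ.+ r) * sumTo (l ℕ.+ r) (λ k → binom (l ℕ.+ r) k * binom (n ℕ.+ k ℕ.+ r) r
                                      * pow x (l ℕ.+ r ℕ.∸ k) * B (n ℕ.+ k) α z))
      × (sumTo (n ℕ.+ r) (λ k → binom (n ℕ.+ r) k * binom (l ℕ.+ k ℕ.+ r) r
                                      * pow x (n ℕ.+ r ℕ.∸ k) * B (l ℕ.+ k) α y)
        ≈ sumTo (l ℕ.+ r) (λ k → binom (l ℕ.+ r) k * binom (n ℕ.+ k ℕ.+ r) r
                                      * pow (- x) (l ℕ.+ r ℕ.∸ k) * B (n ℕ.+ k) α (x + y)))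
  part-i α x y z l n r x+y+z≈α = reflected , shifted
    where
    open Generic l n r
    shifted : genericLeft (λ i → B i α y) x
            ≈ sumTo L (λ k → binom L k * binom (n ℕ.+ k ℕ.+ r) r * pow (- x) (L ∸ k) * B (n ℕ.+ k) α (x + y))
    shifted = trans (generic-identity (λ i → B i α y) x)
                    (sumTo-cong L (λ k → *-congˡ (sym (B-addition (n ℕ.+ k) α x y))))
    z≈ : z ≈ α + - (x + y)
    z≈ = trans (solve 3 (λ x y z → z := (x :+ y :+ z) :+ :- (x :+ y)) refl x y z) (+-congʳ x+y+z≈α)
    termwise : ∀ k → k ≤ L → sgn L * (binom L k * binom (n ℕ.+ k ℕ.+ r) r * pow x (L ∸ k) * B (n ℕ.+ k) α z)
                          ≈ sgn n * (binom L k * binom (n ℕ.+ k ℕ.+ r) r * pow (- x) (L ∸ k) * B (n ℕ.+ k) α (x + y))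
    termwise k k≤ = begin⟨ setoid ⟩
      sgn L * (binom L k * binom (n ℕ.+ k ℕ.+ r) r * pow x (L ∸ k) * B (n ℕ.+ k) α z)
        ≈⟨ *-cong (sgn-split k≤) (*-congˡ (trans (B-cong (n ℕ.+ k) α z≈)
                  (trans (B-reflection (n ℕ.+ k) α (x + y)) (*-congʳ (sgn-+ n k))))) ⟩
      (sgn k * sgn (L ∸ k)) * (binom L k * binom (n ℕ.+ k ℕ.+ r) r * pow x (L ∸ k) * ((sgn n * sgn k) * B (n ℕ.+ k) α (x + y)))
        ≈⟨ solve 7 (λ sk sl b1 b2 p sn bb → (sk :* sl) :* (b1 :* b2 :* p :* ((sn :* sk) :* bb))
                                     := (sk :* sk) :* (sn :* (b1 :* b2 :* (sl :* p) :* bb))) refl _ _ _ _ _ _ _ ⟩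
      (sgn k * sgn k) * (sgn n * (binom L k * binom (n ℕ.+ k ℕ.+ r) r * (sgn (L ∸ k) * pow x (L ∸ k)) * B (n ℕ.+ k) α (x + y)))
        ≈⟨ trans (*-congʳ (sgn-square k)) (*-identityˡ _) ⟩
      sgn n * (binom L k * binom (n ℕ.+ k ℕ.+ r) r * (sgn (L ∸ k) * pow x (L ∸ k)) * B (n ℕ.+ k) α (x + y))
        ≈⟨ *-congˡ (*-congʳ (*-congˡ (sym (pow-neg x (L ∸ k))))) ⟩
      sgn n * (binom L k * binom (n ℕ.+ k ℕ.+ r) r * pow (- x) (L ∸ k) * B (n ℕ.+ k) α (x + y)) ∎
    reflected : sgn n * genericLeft (λ i → B i α y) x
              ≈ sgn L * sumTo L (λ k → binom L k * binom (n ℕ.+ k ℕ.+ r) r * pow x (L ∸ k) * B (n ℕ.+ k) α z)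
    reflected = sym (begin⟨ setoid ⟩
      sgn L * sumTo L (λ k → binom L k * binom (n ℕ.+ k ℕ.+ r) r * pow x (L ∸ k) * B (n ℕ.+ k) α z)
        ≈⟨ trans (sumTo-*l L _ _) (sumTo-cong≤ L termwise) ⟩
      sumTo L (λ k → sgn n * (binom L k * binom (n ℕ.+ k ℕ.+ r) r * pow (- x) (L ∸ k) * B (n ℕ.+ k) α (x + y)))
        ≈⟨ sym (sumTo-*l L _ _) ⟩
      sgn n * sumTo L (λ k → binom L k * binom (n ℕ.+ k ℕ.+ r) r * pow (- x) (L ∸ k) * B (n ℕ.+ k) α (x + y))
        ≈⟨ *-congˡ (sym shifted) ⟩
      sgn n * genericLeft (λ i → B i α y) x ∎)

  vandermonde : ∀ a L R → sumTo R (λ j → binom a j * binom L (R ∸ j)) ≈ binom (L ℕ.+ a) R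
  vandermonde zero L zero = trans (*-congʳ (binom-0 0))
    (trans (*-identityˡ _) (reflexive (P.cong (λ m → binom m 0) (P.sym (ℕP.+-identityʳ L)))))
  vandermonde zero L (suc R) = trans (sumTo-head R _)
    (trans (+-congˡ (sumTo-zero R (λ k _ → trans (*-congʳ (binom-zero {0} {suc k} (s≤s z≤n))) (zeroˡ _))))
    (trans (+-identityʳ _) (trans (*-congʳ (binom-0 0))
    (trans (*-identityˡ _) (reflexive (P.cong (λ m → binom m (suc R)) (P.sym (ℕP.+-identityʳ L))))))))
  vandermonde (suc a) L zero = trans (*-cong (binom-0 (suc a)) (binom-0 L)) (trans (*-identityˡ _) (sym (binom-0 (L ℕ.+ suc a))))
  vandermonde (suc a) L (suc R) = begin⟨ setoid ⟩
    sumTo (suc R) (λ j → binom (suc a) j * binom L (suc R ∸ j))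
      ≈⟨ trans (sumTo-cong (suc R) (λ j → trans (*-congʳ (binom-pascal′ a j)) (distribʳ _ _ _))) (sumTo-+ (suc R) _ _) ⟩
    sumTo (suc R) (λ j → binomPrev a j * binom L (suc R ∸ j)) + sumTo (suc R) (λ j → binom a j * binom L (suc R ∸ j))
      ≈⟨ +-cong (trans (sumTo-head R _) (trans (+-congʳ (zeroˡ _)) (trans (+-identityˡ _) (vandermonde a L R))))
                (vandermonde a L (suc R)) ⟩
    binom (L ℕ.+ a) R + binom (L ℕ.+ a) (suc R)
      ≈⟨ sym (binom-pascal (L ℕ.+ a) R) ⟩
    binom (suc (L ℕ.+ a)) (suc R)
      ≈⟨ reflexive (P.cong (λ m → binom m (suc R)) (P.sym (ℕP.+-suc L a))) ⟩
    binom (L ℕ.+ suc a) (suc R) ∎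

  binom-subset-vanishes : ∀ N j q → ¬ (j ℕ.+ q ≤ N) → binom N j * binom (N ∸ j) q ≈ 0#
  binom-subset-vanishes N j q j+q≰N with j ℕ.≤? N
  ... | no j≰N = trans (*-congʳ (binom-zero (ℕP.≰⇒> j≰N))) (zeroˡ _)
  ... | yes j≤N = trans (*-congˡ (binom-zero (ℕP.≰⇒> λ q≤ →
                    j+q≰N (ℕP.≤-trans (ℕP.+-monoʳ-≤ j q≤) (ℕP.≤-reflexive (ℕP.m+[n∸m]≡n j≤N)))))) (zeroʳ _)

  -- Choosing j then q elements equals choosing q then j: both are N!/(j! q! (N-j-q)!).
  binom-subset-swap : ∀ N j q → binom N j * binom (N ∸ j) q ≈ binom N q * binom (N ∸ q) j
  binom-subset-swap N j q with (j ℕ.+ q) ℕ.≤? N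
  ... | no j+q≰N = trans (binom-subset-vanishes N j q j+q≰N)
                         (sym (binom-subset-vanishes N q j (λ le → j+q≰N (P.subst (_≤ N) (ℕP.+-comm q j) le))))
  ... | yes j+q≤N = begin⟨ setoid ⟩
    binom N j * binom (N ∸ j) q
      ≈⟨ *-cong (binom-formula j≤N) (binom-formula q≤N-j) ⟩
    fact N * (invFact j * invFact (N ∸ j)) * (fact (N ∸ j) * (invFact q * invFact (N ∸ j ∸ q)))
      ≈⟨ solve 6 (λ a b c d e f → a :* (b :* c) :* (d :* (e :* f)) := (d :* c) :* (a :* b :* e :* f)) refl _ _ _ _ _ _ ⟩
    (fact (N ∸ j) * invFact (N ∸ j)) * (fact N * invFact j * invFact q * invFact (N ∸ j ∸ q))
      ≈⟨ trans (*-congʳ (fact-inv (N ∸ j))) (*-identityˡ _) ⟩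
    fact N * invFact j * invFact q * invFact (N ∸ j ∸ q)
      ≈⟨ *-congˡ (reflexive (P.cong invFact rest)) ⟩
    fact N * invFact j * invFact q * invFact (N ∸ q ∸ j)
      ≈⟨ sym (trans (*-congʳ (fact-inv (N ∸ q))) (*-identityˡ _)) ⟩
    (fact (N ∸ q) * invFact (N ∸ q)) * (fact N * invFact j * invFact q * invFact (N ∸ q ∸ j))
      ≈⟨ solve 6 (λ a b c d e f → (a :* b) :* (c :* d :* e :* f) := c :* (e :* b) :* (a :* (d :* f))) refl _ _ _ _ _ _ ⟩
    fact N * (invFact q * invFact (N ∸ q)) * (fact (N ∸ q) * (invFact j * invFact (N ∸ q ∸ j)))
      ≈⟨ sym (*-cong (binom-formula q≤N) (binom-formula j≤N-q)) ⟩
    binom N q * binom (N ∸ q) j ∎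
    where
    j≤N : j ≤ N
    j≤N = ℕP.≤-trans (ℕP.m≤m+n j q) j+q≤N
    q≤N : q ≤ N
    q≤N = ℕP.≤-trans (ℕP.m≤n+m q j) j+q≤N
    q≤N-j : q ≤ N ∸ j
    q≤N-j = P.subst (_≤ N ∸ j) (ℕP.m+n∸m≡n j q) (ℕP.∸-monoˡ-≤ j j+q≤N)
    j≤N-q : j ≤ N ∸ q
    j≤N-q = P.subst (_≤ N ∸ q) (ℕP.m+n∸n≡m j q) (ℕP.∸-monoˡ-≤ q j+q≤N)
    rest : N ∸ j ∸ q P.≡ N ∸ q ∸ j
    rest = P.trans (ℕP.∸-+-assoc N j q) (P.trans (P.cong (N ∸_) (ℕP.+-comm j q)) (P.sym (ℕP.∸-+-assoc N q j)))

  binom-absorption : ∀ m r → binom (m ℕ.+ r) r * fromℕ m ≈ fromℕ (suc r) * binom (m ℕ.+ r) (suc r)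
  binom-absorption zero r = trans (zeroʳ _) (sym (trans (*-congˡ (binom-zero (ℕP.n<1+n r))) (zeroʳ _)))
  binom-absorption (suc m) r = begin⟨ setoid ⟩
    binom (suc m ℕ.+ r) r * fromℕ (suc m)
      ≈⟨ *-congʳ (trans (binom-formula (ℕP.m≤n+m r (suc m))) (*-congˡ (*-congˡ (reflexive (P.cong invFact (ℕP.m+n∸n≡m (suc m) r)))))) ⟩
    fact (suc m ℕ.+ r) * (invFact r * invFact (suc m)) * fromℕ (suc m)
      ≈⟨ solve 4 (λ a b c d → a :* (b :* c) :* d := a :* b :* (d :* c)) refl _ _ _ _ ⟩
    fact (suc m ℕ.+ r) * invFact r * (fromℕ (suc m) * invFact (suc m))
      ≈⟨ *-congˡ (invFact-suc m) ⟩
    fact (suc m ℕ.+ r) * invFact r * invFact m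
      ≈⟨ *-congʳ (*-congˡ (sym (invFact-suc r))) ⟩
    fact (suc m ℕ.+ r) * (fromℕ (suc r) * invFact (suc r)) * invFact m
      ≈⟨ solve 4 (λ a b c d → a :* (b :* c) :* d := b :* (a :* (c :* d))) refl _ _ _ _ ⟩
    fromℕ (suc r) * (fact (suc m ℕ.+ r) * (invFact (suc r) * invFact m))
      ≈⟨ *-congˡ (sym (trans (binom-formula (s≤s (ℕP.m≤n+m r m)))
                             (*-congˡ (*-congˡ (reflexive (P.cong invFact (ℕP.m+n∸n≡m m r))))))) ⟩
    fromℕ (suc r) * binom (suc m ℕ.+ r) (suc r) ∎

  -- Both sides are brought to Σ_{q≤N} (N choose q)(L+N-q choose r+1) x^q Y^{l+N-q-1}:
  -- the left by absorption and reversal, the right by the binomial theorem and Vandermonde.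
  module Evaluation (l n r : ℕ) (x Y W : Carrier) (W≈Y+x : W ≈ Y + x) where
    L N R : ℕ
    L = l ℕ.+ r
    N = n ℕ.+ r
    R = suc r

    exponent : ℕ → ℕ
    exponent q = l ℕ.+ (N ∸ q) ∸ 1

    middle : Carrier
    middle = sumTo N (λ q → binom N q * binom (L ℕ.+ (N ∸ q)) R * (pow x q * pow Y (exponent q)))

    left≈middle : sumTo N (λ k → binom N k * binom (l ℕ.+ k ℕ.+ r) R * pow x (N ∸ k) * pow Y (l ℕ.+ k ∸ 1)) ≈ middle
    left≈middle = trans (sumTo-reverse N _) (sumTo-cong≤ N (λ q q≤ →
       trans (*-congʳ (*-cong (*-cong (sym (binom-sym q≤)) (reflexive (P.cong (λ m → binom m R) (regroup q))))
                              (reflexive (P.cong (pow x) (ℕP.m∸[m∸n]≡n q≤)))))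
       (*-assoc _ _ _)))
      where
      regroup : ∀ q → l ℕ.+ (N ∸ q) ℕ.+ r P.≡ L ℕ.+ (N ∸ q)
      regroup q = P.trans (ℕP.+-assoc l (N ∸ q) r) (P.trans (P.cong (l ℕ.+_) (ℕP.+-comm (N ∸ q) r)) (P.sym (ℕP.+-assoc l r (N ∸ q))))

    exponents-merge : ∀ {j q} → j ℕ.+ q ≤ N → 1 ≤ l ℕ.+ j → (l ℕ.+ j ∸ 1) ℕ.+ ((N ∸ j) ∸ q) P.≡ exponent q
    exponents-merge {j} {q} j+q≤N 1≤l+j =
      P.sym (P.trans (P.cong (λ m → l ℕ.+ m ∸ 1) split) (P.trans (P.cong (_∸ 1) (P.sym (ℕP.+-assoc l j rest))) (ℕP.+-∸-comm rest 1≤l+j)))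
      where
      rest : ℕ
      rest = (N ∸ j) ∸ q
      split : N ∸ q P.≡ j ℕ.+ rest
      split = P.trans (P.cong (_∸ q) (P.sym (ℕP.m+[n∸m]≡n (ℕP.≤-trans (ℕP.m≤m+n j q) j+q≤N))))
                      (ℕP.+-∸-assoc j (P.subst (_≤ N ∸ j) (ℕP.m+n∸m≡n j q) (ℕP.∸-monoˡ-≤ j j+q≤N)))

    coeff : ℕ → ℕ → Carrier
    coeff j q = binom N j * binom (N ∸ j) q * binom L (R ∸ j)

    summand summand′ : ℕ → ℕ → Carrier
    summand j q = coeff j q * (pow x q * (pow Y (l ℕ.+ j ∸ 1) * pow Y ((N ∸ j) ∸ q)))
    summand′ j q = coeff j q * (pow x q * pow Y (exponent q))

    -- If l + j = 0 the factor (L choose r+1-j) = (r choose r+1) vanishes.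
    binom-L-vanishes : ∀ {j} → ¬ (1 ≤ l ℕ.+ j) → binom L (R ∸ j) ≈ 0#
    binom-L-vanishes {j} l+j≱1 = P.subst (λ m → binom L (R ∸ m) ≈ 0#) (P.sym j≡0)
      (P.subst (λ m → binom (m ℕ.+ r) R ≈ 0#) (P.sym l≡0) (binom-zero (ℕP.n<1+n r)))
      where
      l+j≡0 : l ℕ.+ j P.≡ 0
      l+j≡0 = ℕP.n<1⇒n≡0 (ℕP.≰⇒> l+j≱1)
      l≡0 = ℕP.m+n≡0⇒m≡0 l l+j≡0
      j≡0 = ℕP.m+n≡0⇒n≡0 l l+j≡0

    bothZero : ∀ {j q} → coeff j q ≈ 0# → summand j q ≈ summand′ j q
    bothZero c≈0 = trans (trans (*-congʳ c≈0) (zeroˡ _)) (sym (trans (*-congʳ c≈0) (zeroˡ _)))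

    -- The two powers of Y merge, except in cases where the coefficient vanishes anyway.
    summand≈ : ∀ j q → summand j q ≈ summand′ j q
    summand≈ j q with (j ℕ.+ q) ℕ.≤? N | 1 ℕ.≤? l ℕ.+ j
    ... | no j+q≰N | _ = bothZero {j} {q} (trans (*-congʳ (binom-subset-vanishes N j q j+q≰N)) (zeroˡ _))
    ... | yes _ | no l+j≱1 = bothZero {j} {q} (trans (*-congˡ (binom-L-vanishes l+j≱1)) (zeroʳ _))
    ... | yes j+q≤N | yes 1≤l+j = *-congˡ (*-congˡ (trans (sym (pow-+ Y (l ℕ.+ j ∸ 1) ((N ∸ j) ∸ q)))
                                                         (reflexive (P.cong (pow Y) (exponents-merge j+q≤N 1≤l+j)))))

    coeff-sum : ∀ q → sumTo R (λ j → coeff j q) ≈ binom N q * binom (L ℕ.+ (N ∸ q)) R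
    coeff-sum q = trans (sumTo-cong R (λ j → trans (*-congʳ (binom-subset-swap N j q)) (*-assoc _ _ _)))
                        (trans (sym (sumTo-*l R _ _)) (*-congˡ (vandermonde (N ∸ q) L R)))

    right≈middle : sumTo R (λ j → binom N j * binom L (R ∸ j) * pow Y (l ℕ.+ j ∸ 1) * pow W (N ∸ j)) ≈ middle
    right≈middle = begin⟨ setoid ⟩
      sumTo R (λ j → binom N j * binom L (R ∸ j) * pow Y (l ℕ.+ j ∸ 1) * pow W (N ∸ j))
        ≈⟨ sumTo-cong R (λ j → trans (*-congˡ (trans (pow-cong (N ∸ j) W≈Y+x) (binomial-theorem (N ∸ j) Y x)))
             (trans (sumTo-*l (N ∸ j) _ _) (sumTo-cong (N ∸ j) (λ q →
               solve 6 (λ a b p c d e → a :* b :* p :* (c :* d :* e) := a :* c :* b :* (d :* (p :* e))) refl _ _ _ _ _ _)))) ⟩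
      sumTo R (λ j → sumTo (N ∸ j) (summand j))
        ≈⟨ sumTo-cong R (λ j → sym (sumTo-extend (N ∸ j) N (summand j) (ℕP.m∸n≤m N j)
             (λ q q> → trans (*-congʳ (trans (*-congʳ (trans (*-congˡ (binom-zero q>)) (zeroʳ _))) (zeroˡ _))) (zeroˡ _)))) ⟩
      sumTo R (λ j → sumTo N (summand j))
        ≈⟨ sumTo-swap R N _ ⟩
      sumTo N (λ q → sumTo R (λ j → summand j q))
        ≈⟨ sumTo-cong N (λ q → sumTo-cong R (λ j → summand≈ j q)) ⟩
      sumTo N (λ q → sumTo R (λ j → summand′ j q))
        ≈⟨ sumTo-cong N (λ q → trans (sym (sumTo-*r R _ _)) (*-congʳ (coeff-sum q))) ⟩
      middle ∎

    closed-form : sumTo N (λ k → (pow x (N ∸ k) * binom N k * binom (l ℕ.+ k ℕ.+ r) r) * (fromℕ (l ℕ.+ k) * pow Y (l ℕ.+ k ∸ 1)))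
                ≈ fromℕ (suc r) * sumTo R (λ j → binom N j * binom L (R ∸ j) * pow Y (l ℕ.+ j ∸ 1) * pow W (N ∸ j))
    closed-form = begin⟨ setoid ⟩
      sumTo N (λ k → (pow x (N ∸ k) * binom N k * binom (l ℕ.+ k ℕ.+ r) r) * (fromℕ (l ℕ.+ k) * pow Y (l ℕ.+ k ∸ 1)))
        ≈⟨ sumTo-cong N (λ k → trans (solve 5 (λ p b c m y → (p :* b :* c) :* (m :* y) := (c :* m) :* (b :* p :* y)) refl _ _ _ _ _)
             (trans (*-congʳ (binom-absorption (l ℕ.+ k) r))
                    (solve 5 (λ s c b p y → (s :* c) :* (b :* p :* y) := s :* (b :* c :* p :* y)) refl _ _ _ _ _))) ⟩
      sumTo N (λ k → fromℕ (suc r) * (binom N k * binom (l ℕ.+ k ℕ.+ r) R * pow x (N ∸ k) * pow Y (l ℕ.+ k ∸ 1)))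
        ≈⟨ sym (sumTo-*l N _ _) ⟩
      fromℕ (suc r) * sumTo N (λ k → binom N k * binom (l ℕ.+ k ℕ.+ r) R * pow x (N ∸ k) * pow Y (l ℕ.+ k ∸ 1))
        ≈⟨ *-congˡ (trans left≈middle (sym right≈middle)) ⟩
      fromℕ (suc r) * sumTo R (λ j → binom N j * binom L (R ∸ j) * pow Y (l ℕ.+ j ∸ 1) * pow W (N ∸ j)) ∎

  B1-telescope : ∀ m y s → B m 1# y + - B m 1# (y + - fromℕ s) ≈ sum1 s (λ i → fromℕ m * pow (y + - fromℕ i) (m ∸ 1))
  B1-telescope m y zero = trans (+-congˡ (-‿cong (B-cong m 1# (trans (+-congˡ -0#≈0#) (+-identityʳ y))))) (-‿inverseʳ _)
  B1-telescope m y (suc s) = begin⟨ setoid ⟩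
    B m 1# y + - B m 1# (y + - fromℕ (suc s))
      ≈⟨ solve 3 (λ a b c → a :+ :- c := (a :+ :- b) :+ (b :+ :- c)) refl _ (B m 1# (y + - fromℕ s)) _ ⟩
    (B m 1# y + - B m 1# (y + - fromℕ s)) + (B m 1# (y + - fromℕ s) + - B m 1# (y + - fromℕ (suc s)))
      ≈⟨ +-cong (B1-telescope m y s)
                (trans (+-congʳ (B-cong m 1# (solve 2 (λ y f → y :+ :- f := (y :+ :- (κ (+ 1) :+ f)) :+ κ (+ 1)) refl y (fromℕ s))))
                       (B1-difference m (y + - fromℕ (suc s)))) ⟩
    sum1 (suc s) (λ i → fromℕ m * pow (y + - fromℕ i) (m ∸ 1)) ∎

  -- With y′ = y - s we have x + y′ + z = 1, so by part (i) the z-half of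
  -- S equals minus the y-half taken at y′; the difference B_m(y) - B_m(y′) telescopes,
  -- and each resulting sum is evaluated in closed form.
  module PartII (x y z : Carrier) (l n r s : ℕ) (x+y+z≈s+1 : x + y + z ≈ fromℕ (suc s)) where
    open Generic l n r

    y′ : Carrier
    y′ = y + - fromℕ s

    x+y′+z≈1 : x + y′ + z ≈ 1#
    x+y′+z≈1 = trans (solve 4 (λ x y z f → x :+ (y :+ :- f) :+ z := (x :+ y :+ z) :+ :- f) refl x y z (fromℕ s))
               (trans (+-congʳ x+y+z≈s+1) (solve 1 (λ f → (κ (+ 1) :+ f) :+ :- f := κ (+ 1)) refl (fromℕ s)))

    yHalf : Carrier → Carrier
    yHalf w = genericLeft (λ i → B i 1# w) x

    sign-l+n+r+1 : sgn (l ℕ.+ n ℕ.+ r ℕ.+ 1) ≈ - (sgn L * sgn n)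
    sign-l+n+r+1 = trans (sgn-+ (l ℕ.+ n ℕ.+ r) 1) (trans (*-congʳ (trans (reflexive (P.cong sgn regroup)) (sgn-+ L n)))
                     (solve 2 (λ a b → (a :* b) :* ((:- κ (+ 1)) :* κ (+ 1)) := :- (a :* b)) refl (sgn L) (sgn n)))
      where
      regroup : l ℕ.+ n ℕ.+ r P.≡ L ℕ.+ n
      regroup = P.trans (ℕP.+-assoc l n r) (P.trans (P.cong (l ℕ.+_) (ℕP.+-comm n r)) (P.sym (ℕP.+-assoc l r n)))

    zHalf≈ : sgn (l ℕ.+ n ℕ.+ r ℕ.+ 1)
               * sumTo L (λ k → pow x (L ∸ k) * binom L k * binom (n ℕ.+ k ℕ.+ r) r * B (n ℕ.+ k) 1# z)
           ≈ - yHalf y′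
    zHalf≈ = begin⟨ setoid ⟩
      sgn (l ℕ.+ n ℕ.+ r ℕ.+ 1) * sumTo L (λ k → pow x (L ∸ k) * binom L k * binom (n ℕ.+ k ℕ.+ r) r * B (n ℕ.+ k) 1# z)
        ≈⟨ *-cong sign-l+n+r+1 (sumTo-cong L (λ k → *-congʳ (solve 3 (λ p a b → p :* a :* b := a :* b :* p) refl _ _ _))) ⟩
      - (sgn L * sgn n) * zSum
        ≈⟨ solve 3 (λ a b p → :- (a :* b) :* p := :- (b :* (a :* p))) refl _ _ _ ⟩
      - (sgn n * (sgn L * zSum))
        ≈⟨ -‿cong (*-congˡ (sym (proj₁ (part-i 1# x y′ z l n r x+y′+z≈1)))) ⟩
      - (sgn n * (sgn n * yHalf y′))
        ≈⟨ -‿cong (trans (sym (*-assoc _ _ _)) (trans (*-congʳ (sgn-square n)) (*-identityˡ _))) ⟩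
      - yHalf y′ ∎
      where
      zSum : Carrier
      zSum = sumTo L (λ k → binom L k * binom (n ℕ.+ k ℕ.+ r) r * pow x (L ∸ k) * B (n ℕ.+ k) 1# z)

    S-as-difference : S n l r 1# x y z ≈ yHalf y + - yHalf y′
    S-as-difference = +-cong (sumTo-cong N (λ k → *-congʳ (solve 3 (λ p a b → p :* a :* b := a :* b :* p) refl _ _ _))) zHalf≈

    coef : ℕ → Carrier
    coef k = binom N k * binom (l ℕ.+ k ℕ.+ r) r * pow x (N ∸ k)

    closed-form-at : ∀ i → sumTo N (λ k → coef k * (fromℕ (l ℕ.+ k) * pow (y + - fromℕ i) (l ℕ.+ k ∸ 1)))
      ≈ fromℕ (suc r) * sumTo (suc r) (λ j → binom N j * binom L (suc r ∸ j)
                                            * pow (y - fromℕ i) (l ℕ.+ j ∸ 1) * pow (x + y - fromℕ i) (N ∸ j))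
    closed-form-at i = trans (sumTo-cong N (λ k → *-congʳ (solve 3 (λ a b p → a :* b :* p := p :* a :* b) refl _ _ _)))
      (Evaluation.closed-form l n r x (y + - fromℕ i) (x + y - fromℕ i)
         (solve 3 (λ x y f → x :+ y :+ :- f := (y :+ :- f) :+ x) refl x y (fromℕ i)))

    part-ii : S n l r 1# x y z
        ≈ fromℕ (suc r) * sum1 s (λ k → sumTo (suc r) (λ j →
            binom (n ℕ.+ r) j * binom (l ℕ.+ r) (suc r ℕ.∸ j)
            * pow (y - fromℕ k) (l ℕ.+ j ℕ.∸ 1) * pow (x + y - fromℕ k) (n ℕ.+ r ℕ.∸ j)))
    part-ii = begin⟨ setoid ⟩
      S n l r 1# x y z
        ≈⟨ S-as-difference ⟩
      yHalf y + - yHalf y′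
        ≈⟨ trans (+-congˡ (sumTo-neg N _)) (sym (sumTo-+ N _ _)) ⟩
      sumTo N (λ k → coef k * B (l ℕ.+ k) 1# y + - (coef k * B (l ℕ.+ k) 1# y′))
        ≈⟨ sumTo-cong N (λ k → trans (solve 3 (λ c a b → c :* a :+ :- (c :* b) := c :* (a :+ :- b)) refl _ _ _)
                                     (*-congˡ (B1-telescope (l ℕ.+ k) y s))) ⟩
      sumTo N (λ k → coef k * sum1 s (λ i → fromℕ (l ℕ.+ k) * pow (y + - fromℕ i) (l ℕ.+ k ∸ 1)))
        ≈⟨ trans (sumTo-cong N (λ k → sum1-*l s _ _)) (sum1-sumTo-swap N s _) ⟩
      sum1 s (λ i → sumTo N (λ k → coef k * (fromℕ (l ℕ.+ k) * pow (y + - fromℕ i) (l ℕ.+ k ∸ 1))))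
        ≈⟨ sum1-cong s closed-form-at ⟩
      sum1 s (λ i → fromℕ (suc r) * sumTo (suc r) (λ j → binom N j * binom L (suc r ∸ j)
                                              * pow (y - fromℕ i) (l ℕ.+ j ∸ 1) * pow (x + y - fromℕ i) (N ∸ j)))
        ≈⟨ sym (sum1-*l s _ _) ⟩
      fromℕ (suc r) * sum1 s (λ k → sumTo (suc r) (λ j →
              binom N j * binom L (suc r ∸ j) * pow (y - fromℕ k) (l ℕ.+ j ∸ 1) * pow (x + y - fromℕ k) (N ∸ j))) ∎

mainTheorem6 : ∀ {c ℓ} (A : QAlgebra c ℓ) → let open Bernoulli A in
    (∀ (α x y z : Carrier) (l n r : ℕ) → x + y + z ≈ α →
      (sgn n * sumTo (n ℕ.+ r) (λ k → binom (n ℕ.+ r) k * binom (l ℕ.+ k ℕ.+ r) r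
                                      * pow x (n ℕ.+ r ℕ.∸ k) * B (l ℕ.+ k) α y)
        ≈ sgn (l ℕ.+ r) * sumTo (l ℕ.+ r) (λ k → binom (l ℕ.+ r) k * binom (n ℕ.+ k ℕ.+ r) r
                                      * pow x (l ℕ.+ r ℕ.∸ k) * B (n ℕ.+ k) α z))
      × (sumTo (n ℕ.+ r) (λ k → binom (n ℕ.+ r) k * binom (l ℕ.+ k ℕ.+ r) r
                                      * pow x (n ℕ.+ r ℕ.∸ k) * B (l ℕ.+ k) α y)
        ≈ sumTo (l ℕ.+ r) (λ k → binom (l ℕ.+ r) k * binom (n ℕ.+ k ℕ.+ r) r
                                      * pow (- x) (l ℕ.+ r ℕ.∸ k) * B (n ℕ.+ k) α (x + y))))
    × (∀ (x y z : Carrier) (l n r s : ℕ) → x + y + z ≈ fromℕ (suc s) →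
      S n l r 1# x y z
        ≈ fromℕ (suc r) * sum1 s (λ k → sumTo (suc r) (λ j →
            binom (n ℕ.+ r) j * binom (l ℕ.+ r) (suc r ℕ.∸ j)
            * pow (y - fromℕ k) (l ℕ.+ j ℕ.∸ 1) * pow (x + y - fromℕ k) (n ℕ.+ r ℕ.∸ j))))
mainTheorem6 A = Theory.part-i A , λ x y z l n r s hyp → Theory.PartII.part-ii A x y z l n r s hyp
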